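{- Let $k\ge 0$ and $N\ge 0$ be integers. Then $$\det\left(g_k(\gamma)|_N\right)=\begin{cases}1 & \text{if } N=(2k+1)n \text{ for some integer } n\ge 0,\\ (-1)^{\binom{k+1}{2}} & \text{if } N=(2k+1)n+k+1 \text{ for some integer } n\ge 0,\\ 0 & \text{otherwise.}\end{cases}$$
   Context: $\gamma$ is the infinite matrix indexed by $\mathbb{Z}_{\ge0}$ with $(i,j)$ entry $1$ if $|i-j|=1$ or $i=j=0$, $0$ otherwise; polynomials in $\gamma$ are well-defined (rows and columns finitely supported). $M|_n$ denotes the leading principal $n\times n$ submatrix of $M$; $\gamma_n=\gamma|_n$, and $g_n(x)=\det(xI_n-\gamma_n)$ with $g_0=1$. The determinant of a $0\times0$ matrix is $1$. -}

module Defs where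

open import Data.Nat as ℕ using (ℕ; zero; suc)
open import Data.Integer as ℤ using (ℤ; +_; 0ℤ; 1ℤ)
open import Data.Fin using (Fin; zero; suc; punchIn; toℕ)
open import Data.List using (List; []; _∷_)
open import Data.Bool using (Bool; true; false; if_then_else_; _∧_; _∨_)

-- Minimal commutative-ring operations (no laws needed to state things)

record RingOps (A : Set) : Set where
  field
    0# 1# : A
    _+_ _*_ : A → A → A
    -_ : A → A

SqMat : Set → ℕ → Set
SqMat A n = Fin n → Fin n → A

module _ {A : Set} (R : RingOps A) where
  open RingOps R

  sumFin : {n : ℕ} → (Fin n → A) → A
  sumFin {zero} f = 0#
  sumFin {suc n} f = f zero + sumFin (λ i → f (suc i))

  sign : ℕ → A
  sign zero = 1#
  sign (suc m) = - sign m

  det : {n : ℕ} → SqMat A n → A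
  det {zero} M = 1#
  det {suc n} M =
    sumFin (λ j → (sign (toℕ j) * M zero j) * det (λ a b → M (suc a) (punchIn j b)))

ℤOps : RingOps ℤ
ℤOps = record { 0# = 0ℤ ; 1# = 1ℤ ; _+_ = ℤ._+_ ; _*_ = ℤ._*_ ; -_ = ℤ.-_ }

-- polynomials over ℤ as coefficient lists, constant term first
Poly : Set
Poly = List ℤ

padd : Poly → Poly → Poly
padd [] q = q
padd (a ∷ p) [] = a ∷ p
padd (a ∷ p) (b ∷ q) = (a ℤ.+ b) ∷ padd p q

pscale : ℤ → Poly → Poly
pscale c [] = []
pscale c (a ∷ p) = (c ℤ.* a) ∷ pscale c p

pmul : Poly → Poly → Poly
pmul [] q = []
pmul (a ∷ p) q = padd (pscale a q) (0ℤ ∷ pmul p q)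

pneg : Poly → Poly
pneg = pscale (ℤ.- 1ℤ)

PolyOps : RingOps Poly
PolyOps = record { 0# = [] ; 1# = 1ℤ ∷ [] ; _+_ = padd ; _*_ = pmul ; -_ = pneg }

pconst : ℤ → Poly
pconst c = c ∷ []

pX : Poly
pX = 0ℤ ∷ 1ℤ ∷ []

InfMat : Set
InfMat = ℕ → ℕ → ℤ

γ : InfMat
γ i j = if ((suc i ℕ.≡ᵇ j) ∨ (suc j ℕ.≡ᵇ i)) ∨ ((i ℕ.≡ᵇ 0) ∧ (j ℕ.≡ᵇ 0)) then 1ℤ else 0ℤ

idInf : InfMat
idInf i j = if i ℕ.≡ᵇ j then 1ℤ else 0ℤ

sumBelow : ℕ → (ℕ → ℤ) → ℤ
sumBelow zero f = 0ℤ
sumBelow (suc n) f = sumBelow n f ℤ.+ f n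

-- (γ B)_{ab} = Σ_l γ_{al} B_{lb}; row a of γ vanishes for l ≥ a+2,
-- so the sum over l < a+2 is the full (finitely supported) sum.
γmul : InfMat → InfMat
γmul B a b = sumBelow (suc (suc a)) (λ l → γ a l ℤ.* B l b)

-- p(γ) for p = c₀ + x q(x):  p(γ) = c₀ I + γ q(γ)
evalγ : Poly → InfMat
evalγ [] a b = 0ℤ
evalγ (c ∷ p) a b = (c ℤ.* idInf a b) ℤ.+ γmul (evalγ p) a b

trunc : (n : ℕ) → InfMat → SqMat ℤ n
trunc n M i j = M (toℕ i) (toℕ j)

γ_ : (n : ℕ) → SqMat ℤ n
γ_ n = trunc n γ

g : ℕ → Poly
g n = det PolyOps (λ i j → padd (if toℕ i ℕ.≡ᵇ toℕ j then pX else []) (pneg (pconst (γ_ n i j))))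

module Submission where

-- Plan.  (1) A toolkit for the determinants Det n F of the leading n×n blocks
-- of ℕ-indexed integer matrices (Defs' det expands along row 0): invariance
-- under transposition and under reversal of rows and columns, additivity and
-- alternation in adjacent columns, expansion along a row or column with a
-- single non-zero entry, peeling off unit rows and columns, and invariance
-- under adding to every row its predecessor.  (2) The three-term recurrence
-- g (n+1) = x g n - g (n-1), proved at every integer x by tridiagonal
-- expansion and transferred to coefficients by the identity principle; hence
-- g (k+1)(γ) = γ g k (γ) - g (k-1)(γ).  (3) The closed form
-- g k (γ)_ab = c(|a-b|) + c(a+b+1), c(n) = (-1)^(k+n) [n ≤ k].  (4) Adding to each
-- row its predecessor gives a 0/1 matrix B k with the same minors.  (5) Peeling
-- the bottom-right corner of B k |_(p+2k+1) leaves B k |_p, so the minors have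
-- period 2k+1.  (6) The sizes up to 2k give 1, 0, the anti-diagonal sign, and 0.

open import Defs hiding (γ_)
open import Data.Bool using (true; false; if_then_else_)
open import Data.Empty using (⊥-elim)
open import Data.Fin using (Fin; zero; suc; toℕ; punchIn)
open import Data.Fin.Properties using (toℕ<n)
open import Data.Integer using (ℤ; +_; -_; 0ℤ; 1ℤ; ∣_∣; _^_) renaming (_+_ to _+ᶻ_; _*_ to _*ᶻ_)
import Data.Integer.Properties as ℤP
open import Data.Integer.Tactic.RingSolver using (solve-∀)
open import Data.List using ([]; _∷_)
open import Data.Nat using (ℕ; zero; suc; pred; _+_; _*_; _∸_; _≡ᵇ_; _<_; _≤_; z≤n; s≤s; _≟_; _<?_; _≤?_)
open import Data.Nat.Combinatorics using (_C_; nC1≡n; nCk+nC[k+1]≡[n+1]C[k+1])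
open import Data.Nat.DivMod using (_/_; _%_; m≡m%n+[m/n]*n; m%n<n)
import Data.Nat.Properties as ℕP
import Data.Nat.Tactic.RingSolver as ℕSolver
open import Data.Product using (_×_; _,_; proj₁; ∃-syntax)
open import Function using (_∘_)
open import Relation.Binary.Definitions using (tri<; tri≈; tri>)
open import Relation.Binary.PropositionalEquality using (_≡_; _≢_; refl; sym; trans; cong; cong₂; subst; module ≡-Reasoning)
open import Relation.Nullary using (¬_; yes; no; does)
open import Relation.Nullary.Decidable using (dec-true; dec-false)

Σᶠ : {n : ℕ} → (Fin n → ℤ) → ℤ
Σᶠ = sumFin ℤOps

detᶠ : {n : ℕ} → SqMat ℤ n → ℤ
detᶠ = det ℤOps

sgn : ℕ → ℤ
sgn = sign ℤOps

Σᶠ-cong : ∀ {n} {f h : Fin n → ℤ} → (∀ i → f i ≡ h i) → Σᶠ f ≡ Σᶠ h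
Σᶠ-cong {zero} e = refl
Σᶠ-cong {suc n} e = cong₂ _+ᶻ_ (e zero) (Σᶠ-cong (e ∘ suc))

Σᶠ-zero : ∀ {n} {f : Fin n → ℤ} → (∀ i → f i ≡ 0ℤ) → Σᶠ f ≡ 0ℤ
Σᶠ-zero {zero} e = refl
Σᶠ-zero {suc n} e = cong₂ _+ᶻ_ (e zero) (Σᶠ-zero (e ∘ suc))

Σᶠ-+ : ∀ {n} (f h : Fin n → ℤ) → Σᶠ (λ i → f i +ᶻ h i) ≡ Σᶠ f +ᶻ Σᶠ h
Σᶠ-+ {zero} f h = refl
Σᶠ-+ {suc n} f h =
  trans (cong ((f zero +ᶻ h zero) +ᶻ_) (Σᶠ-+ (f ∘ suc) (h ∘ suc)))
        (interchange (f zero) (h zero) (Σᶠ (f ∘ suc)) (Σᶠ (h ∘ suc)))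
  where
  interchange : ∀ a b c d → (a +ᶻ b) +ᶻ (c +ᶻ d) ≡ (a +ᶻ c) +ᶻ (b +ᶻ d)
  interchange = solve-∀

Σᶠ-*ˡ : ∀ {n} c (f : Fin n → ℤ) → Σᶠ (λ i → c *ᶻ f i) ≡ c *ᶻ Σᶠ f
Σᶠ-*ˡ {zero} c f = sym (ℤP.*-zeroʳ c)
Σᶠ-*ˡ {suc n} c f = trans (cong ((c *ᶻ f zero) +ᶻ_) (Σᶠ-*ˡ c (f ∘ suc)))
                          (sym (ℤP.*-distribˡ-+ c (f zero) _))

Σᶠ-swap : ∀ {n m} (f : Fin n → Fin m → ℤ) →
  Σᶠ (λ j → Σᶠ (λ i → f j i)) ≡ Σᶠ (λ i → Σᶠ (λ j → f j i))
Σᶠ-swap {zero} {m} f = sym (Σᶠ-zero {m} (λ _ → refl))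
Σᶠ-swap {suc n} f = trans (cong (Σᶠ (f zero) +ᶻ_) (Σᶠ-swap (f ∘ suc)))
                          (sym (Σᶠ-+ (f zero) (λ i → Σᶠ (λ j → f (suc j) i))))

detᶠ-cong : ∀ {n} {M M' : SqMat ℤ n} → (∀ i j → M i j ≡ M' i j) → detᶠ M ≡ detᶠ M'
detᶠ-cong {zero} e = refl
detᶠ-cong {suc n} e = Σᶠ-cong λ j →
  cong₂ _*ᶻ_ (cong (sgn (toℕ j) *ᶻ_) (e zero j)) (detᶠ-cong (λ a b → e (suc a) (punchIn j b)))

_ᵀ : ∀ {n} → SqMat ℤ n → SqMat ℤ n
(M ᵀ) i j = M j i

-- Expanding twice along the first row, and then (using transposition
-- invariance in smaller sizes) along the first column of the minors,
-- writes det M as M₀₀ det(M minus row/column 0) plus a double sum whose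
-- terms pair the entries M₀,ⱼ₊₁ and Mᵢ₊₁,₀; this form is symmetric
-- under transposition.
minor₂ : ∀ {n} → SqMat ℤ (suc (suc n)) → Fin (suc n) → Fin (suc n) → SqMat ℤ n
minor₂ M i j a b = M (suc (punchIn i a)) (suc (punchIn j b))

term₂ : ∀ {n} → SqMat ℤ (suc (suc n)) → Fin (suc n) → Fin (suc n) → ℤ
term₂ M j i =
  - (((sgn (toℕ i) *ᶻ sgn (toℕ j)) *ᶻ (M zero (suc j) *ᶻ M (suc i) zero)) *ᶻ detᶠ (minor₂ M i j))

detᶠ-expand₂ : ∀ {n} →
  (∀ (A : SqMat ℤ (suc n)) → detᶠ (A ᵀ) ≡ detᶠ A) →
  (∀ (A : SqMat ℤ n) → detᶠ (A ᵀ) ≡ detᶠ A) →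
  ∀ (M : SqMat ℤ (suc (suc n))) →
  detᶠ M ≡ M zero zero *ᶻ detᶠ (λ a b → M (suc a) (suc b)) +ᶻ Σᶠ (λ j → Σᶠ (λ i → term₂ M j i))
detᶠ-expand₂ {n} transpose₁ transpose₀ M =
  cong₂ _+ᶻ_ (cong (_*ᶻ detᶠ (λ a b → M (suc a) (suc b))) (ℤP.*-identityˡ (M zero zero))) (Σᶠ-cong {suc n} column)
  where
  column : ∀ j → (sgn (toℕ (suc j)) *ᶻ M zero (suc j)) *ᶻ detᶠ (λ a b → M (suc a) (punchIn (suc j) b))
               ≡ Σᶠ (λ i → term₂ M j i)
  column j = begin
      c *ᶻ detᶠ A                          ≡⟨ cong (c *ᶻ_) (sym (transpose₁ A)) ⟩
      c *ᶻ detᶠ (A ᵀ)                      ≡⟨ cong (c *ᶻ_) (Σᶠ-cong {suc n} λ i →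
                                                 cong ((sgn (toℕ i) *ᶻ M (suc i) zero) *ᶻ_) (transpose₀ (minor₂ M i j))) ⟩
      c *ᶻ Σᶠ (λ i → (sgn (toℕ i) *ᶻ M (suc i) zero) *ᶻ detᶠ (minor₂ M i j))
                                           ≡⟨ sym (Σᶠ-*ˡ c (λ i → (sgn (toℕ i) *ᶻ M (suc i) zero) *ᶻ detᶠ (minor₂ M i j))) ⟩
      Σᶠ (λ i → c *ᶻ ((sgn (toℕ i) *ᶻ M (suc i) zero) *ᶻ detᶠ (minor₂ M i j)))
                                           ≡⟨ Σᶠ-cong {suc n} (λ i → regroup (sgn (toℕ j)) (M zero (suc j))
                                                 (sgn (toℕ i)) (M (suc i) zero) (detᶠ (minor₂ M i j))) ⟩
      Σᶠ (λ i → term₂ M j i)               ∎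
    where
    open ≡-Reasoning
    c = sgn (toℕ (suc j)) *ᶻ M zero (suc j)
    A : SqMat ℤ (suc n)
    A a b = M (suc a) (punchIn (suc j) b)
    regroup : ∀ sj m si mi d → ((- sj) *ᶻ m) *ᶻ ((si *ᶻ mi) *ᶻ d) ≡ - (((si *ᶻ sj) *ᶻ (m *ᶻ mi)) *ᶻ d)
    regroup = solve-∀

detᶠ-transpose : ∀ {n} (M : SqMat ℤ n) → detᶠ (M ᵀ) ≡ detᶠ M
detᶠ-transpose {zero} M = refl
detᶠ-transpose {suc zero} M = refl
detᶠ-transpose {suc (suc n)} M = begin
    detᶠ (M ᵀ)
      ≡⟨ detᶠ-expand₂ detᶠ-transpose detᶠ-transpose (M ᵀ) ⟩
    M zero zero *ᶻ detᶠ (M₁₁ ᵀ) +ᶻ Σᶠ (λ j → Σᶠ (λ i → term₂ (M ᵀ) j i))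
      ≡⟨ cong₂ _+ᶻ_ (cong (M zero zero *ᶻ_) (detᶠ-transpose M₁₁))
                    (trans (Σᶠ-cong λ j → Σᶠ-cong λ i → term₂-transpose j i) (Σᶠ-swap (λ j i → term₂ M i j))) ⟩
    M zero zero *ᶻ detᶠ M₁₁ +ᶻ Σᶠ (λ j → Σᶠ (λ i → term₂ M j i))
      ≡⟨ sym (detᶠ-expand₂ detᶠ-transpose detᶠ-transpose M) ⟩
    detᶠ M ∎
  where
  open ≡-Reasoning
  M₁₁ : SqMat ℤ (suc n)
  M₁₁ a b = M (suc a) (suc b)
  swapFactors : ∀ si sj a b d → - (((si *ᶻ sj) *ᶻ (a *ᶻ b)) *ᶻ d) ≡ - (((sj *ᶻ si) *ᶻ (b *ᶻ a)) *ᶻ d)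
  swapFactors = solve-∀
  term₂-transpose : ∀ j i → term₂ (M ᵀ) j i ≡ term₂ M i j
  term₂-transpose j i =
    trans (cong (λ d → - (((sgn (toℕ i) *ᶻ sgn (toℕ j)) *ᶻ (M (suc j) zero *ᶻ M zero (suc i))) *ᶻ d))
                (detᶠ-transpose (minor₂ M j i)))
          (swapFactors (sgn (toℕ i)) (sgn (toℕ j)) (M (suc j) zero) (M zero (suc i)) (detᶠ (minor₂ M j i)))

ΣN : ℕ → (ℕ → ℤ) → ℤ
ΣN n f = Σᶠ {n} (λ i → f (toℕ i))

ΣN-cong : ∀ n {f h : ℕ → ℤ} → (∀ i → i < n → f i ≡ h i) → ΣN n f ≡ ΣN n h
ΣN-cong n e = Σᶠ-cong {n} (λ i → e (toℕ i) (toℕ<n i))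

ΣN-zero : ∀ n {f : ℕ → ℤ} → (∀ i → i < n → f i ≡ 0ℤ) → ΣN n f ≡ 0ℤ
ΣN-zero n e = Σᶠ-zero {n} (λ i → e (toℕ i) (toℕ<n i))

ΣN-+ : ∀ n (f h : ℕ → ℤ) → ΣN n (λ i → f i +ᶻ h i) ≡ ΣN n f +ᶻ ΣN n h
ΣN-+ n f h = Σᶠ-+ {n} (λ i → f (toℕ i)) (λ i → h (toℕ i))

ΣN-*ˡ : ∀ n c (f : ℕ → ℤ) → ΣN n (λ i → c *ᶻ f i) ≡ c *ᶻ ΣN n f
ΣN-*ˡ n c f = Σᶠ-*ˡ {n} c (λ i → f (toℕ i))

ΣN-single : ∀ n c (f : ℕ → ℤ) → c < n → (∀ i → i < n → i ≢ c → f i ≡ 0ℤ) → ΣN n f ≡ f c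
ΣN-single (suc n) zero f _ e =
  trans (cong (f 0 +ᶻ_) (ΣN-zero n (λ i i<n → e (suc i) (s≤s i<n) (λ ())))) (ℤP.+-identityʳ _)
ΣN-single (suc n) (suc c) f (s≤s c<n) e =
  trans (cong (_+ᶻ ΣN n (f ∘ suc)) (e 0 (s≤s z≤n) (λ ())))
  (trans (ℤP.+-identityˡ _)
         (ΣN-single n c (f ∘ suc) c<n (λ i i<n i≢c → e (suc i) (s≤s i<n) (i≢c ∘ ℕP.suc-injective))))

ΣN-pair : ∀ n c d (f : ℕ → ℤ) → c < n → d < n → c ≢ d →
  (∀ i → i < n → i ≢ c → i ≢ d → f i ≡ 0ℤ) → ΣN n f ≡ f c +ᶻ f d
ΣN-pair (suc n) zero zero f _ _ c≢d e = ⊥-elim (c≢d refl)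
ΣN-pair (suc n) zero (suc d) f _ (s≤s d<n) _ e =
  cong (f 0 +ᶻ_) (ΣN-single n d (f ∘ suc) d<n
    (λ i i<n i≢d → e (suc i) (s≤s i<n) (λ ()) (i≢d ∘ ℕP.suc-injective)))
ΣN-pair (suc n) (suc c) zero f (s≤s c<n) _ _ e =
  trans (cong (f 0 +ᶻ_) (ΣN-single n c (f ∘ suc) c<n
          (λ i i<n i≢c → e (suc i) (s≤s i<n) (i≢c ∘ ℕP.suc-injective) (λ ()))))
        (ℤP.+-comm (f 0) (f (suc c)))
ΣN-pair (suc n) (suc c) (suc d) f (s≤s c<n) (s≤s d<n) c≢d e =
  trans (cong (_+ᶻ ΣN n (f ∘ suc)) (e 0 (s≤s z≤n) (λ ()) (λ ())))
  (trans (ℤP.+-identityˡ _)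
         (ΣN-pair n c d (f ∘ suc) c<n d<n (c≢d ∘ cong suc)
            (λ i i<n i≢c i≢d → e (suc i) (s≤s i<n) (i≢c ∘ ℕP.suc-injective) (i≢d ∘ ℕP.suc-injective))))

ΣN-snoc : ∀ n (f : ℕ → ℤ) → ΣN (suc n) f ≡ ΣN n f +ᶻ f n
ΣN-snoc zero f = trans (ℤP.+-identityʳ (f 0)) (sym (ℤP.+-identityˡ (f 0)))
ΣN-snoc (suc n) f = trans (cong (f 0 +ᶻ_) (ΣN-snoc n (f ∘ suc)))
                          (sym (ℤP.+-assoc (f 0) (ΣN n (f ∘ suc)) (f (suc n))))

ΣN-reverse : ∀ n (f : ℕ → ℤ) → ΣN (suc n) (λ c → f (n ∸ c)) ≡ ΣN (suc n) f
ΣN-reverse zero f = refl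
ΣN-reverse (suc n) f = begin
    f (suc n) +ᶻ ΣN (suc n) (λ c → f (n ∸ c)) ≡⟨ cong (f (suc n) +ᶻ_) (ΣN-reverse n f) ⟩
    f (suc n) +ᶻ ΣN (suc n) f                 ≡⟨ ℤP.+-comm (f (suc n)) (ΣN (suc n) f) ⟩
    ΣN (suc n) f +ᶻ f (suc n)                 ≡⟨ sym (ΣN-snoc (suc n) f) ⟩
    ΣN (suc (suc n)) f                        ∎
  where open ≡-Reasoning

δ : ℕ → ℕ → ℤ
δ x y = if x ≡ᵇ y then 1ℤ else 0ℤ

≡ᵇ-refl : ∀ x → (x ≡ᵇ x) ≡ true
≡ᵇ-refl zero = refl
≡ᵇ-refl (suc x) = ≡ᵇ-refl x

≡ᵇ-≢ : ∀ {x y} → x ≢ y → (x ≡ᵇ y) ≡ false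
≡ᵇ-≢ {zero} {zero} x≢y = ⊥-elim (x≢y refl)
≡ᵇ-≢ {zero} {suc y} _ = refl
≡ᵇ-≢ {suc x} {zero} _ = refl
≡ᵇ-≢ {suc x} {suc y} x≢y = ≡ᵇ-≢ (x≢y ∘ cong suc)

δ-≡ : ∀ {x y} → x ≡ y → δ x y ≡ 1ℤ
δ-≡ {x} refl = cong (λ t → if t then 1ℤ else 0ℤ) (≡ᵇ-refl x)

δ-≢ : ∀ {x y} → x ≢ y → δ x y ≡ 0ℤ
δ-≢ x≢y = cong (λ t → if t then 1ℤ else 0ℤ) (≡ᵇ-≢ x≢y)

δ-iff : ∀ {x y x' y'} → (x ≡ y → x' ≡ y') → (x' ≡ y' → x ≡ y) → δ x y ≡ δ x' y'
δ-iff {x} {y} to from with x ≟ y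
... | yes x≡y = trans (δ-≡ x≡y) (sym (δ-≡ (to x≡y)))
... | no x≢y = trans (δ-≢ x≢y) (sym (δ-≢ (x≢y ∘ from)))

sgn-+ : ∀ a b → sgn (a + b) ≡ sgn a *ᶻ sgn b
sgn-+ zero b = sym (ℤP.*-identityˡ (sgn b))
sgn-+ (suc a) b = trans (cong -_ (sgn-+ a b)) (ℤP.neg-distribˡ-* (sgn a) (sgn b))

sgn-square : ∀ a → sgn a *ᶻ sgn a ≡ 1ℤ
sgn-square zero = refl
sgn-square (suc a) = trans (negSquare (sgn a)) (sgn-square a)
  where
  negSquare : ∀ s → (- s) *ᶻ (- s) ≡ s *ᶻ s
  negSquare = solve-∀

sgn-∸ : ∀ c n → c ≤ n → sgn c ≡ sgn n *ᶻ sgn (n ∸ c)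
sgn-∸ c n c≤n = begin
    sgn c                                        ≡⟨ sym (ℤP.*-identityʳ (sgn c)) ⟩
    sgn c *ᶻ 1ℤ                                  ≡⟨ cong (sgn c *ᶻ_) (sym (sgn-square (n ∸ c))) ⟩
    sgn c *ᶻ (sgn (n ∸ c) *ᶻ sgn (n ∸ c))        ≡⟨ sym (ℤP.*-assoc (sgn c) _ _) ⟩
    (sgn c *ᶻ sgn (n ∸ c)) *ᶻ sgn (n ∸ c)        ≡⟨ cong (_*ᶻ sgn (n ∸ c)) (sym (sgn-+ c (n ∸ c))) ⟩
    sgn (c + (n ∸ c)) *ᶻ sgn (n ∸ c)             ≡⟨ cong (λ m → sgn m *ᶻ sgn (n ∸ c)) (ℕP.m+[n∸m]≡n c≤n) ⟩
    sgn n *ᶻ sgn (n ∸ c)                         ∎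
  where open ≡-Reasoning

Det : ℕ → InfMat → ℤ
Det n F = detᶠ (trunc n F)

Det-cong : ∀ n {F G : InfMat} → (∀ a b → a < n → b < n → F a b ≡ G a b) → Det n F ≡ Det n G
Det-cong n e = detᶠ-cong (λ i j → e (toℕ i) (toℕ j) (toℕ<n i) (toℕ<n j))

Det-transpose : ∀ n (F : InfMat) → Det n (λ a b → F b a) ≡ Det n F
Det-transpose n F = detᶠ-transpose (trunc n F)

-- skip c r b is the b-th element of ℕ ∖ {c, …, c + r - 1};
-- pin c = skip c 1 enumerates the columns left when column c is deleted.
skip : ℕ → ℕ → ℕ → ℕ
skip zero r b = r + b
skip (suc c) r zero = zero
skip (suc c) r (suc b) = suc (skip c r b)

pin : ℕ → ℕ → ℕ
pin c = skip c 1

toℕ-punchIn : ∀ {n} (c : Fin (suc n)) (b : Fin n) → toℕ (punchIn c b) ≡ pin (toℕ c) (toℕ b)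
toℕ-punchIn zero b = refl
toℕ-punchIn (suc c) zero = refl
toℕ-punchIn (suc c) (suc b) = cong suc (toℕ-punchIn c b)

minor : ℕ → InfMat → InfMat
minor c F a b = F (suc a) (pin c b)

rowTerm : ℕ → InfMat → ℕ → ℤ
rowTerm n F c = (sgn c *ᶻ F 0 c) *ᶻ Det n (minor c F)

Det-expand : ∀ n (F : InfMat) → Det (suc n) F ≡ ΣN (suc n) (rowTerm n F)
Det-expand n F = Σᶠ-cong {suc n} λ j →
  cong ((sgn (toℕ j) *ᶻ F 0 (toℕ j)) *ᶻ_)
       (detᶠ-cong {n} (λ a b → cong (F (suc (toℕ a))) (toℕ-punchIn j b)))

rowTerm-zero : ∀ n (F : InfMat) c → F 0 c ≡ 0ℤ → rowTerm n F c ≡ 0ℤ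
rowTerm-zero n F c F0c≡0 =
  trans (cong (λ x → (sgn c *ᶻ x) *ᶻ Det n (minor c F)) F0c≡0)
        (trans (cong (_*ᶻ Det n (minor c F)) (ℤP.*-zeroʳ (sgn c))) (ℤP.*-zeroˡ (Det n (minor c F))))

skip-below : ∀ c r b → b < c → skip c r b ≡ b
skip-below (suc c) r zero _ = refl
skip-below (suc c) r (suc b) (s≤s b<c) = cong suc (skip-below c r b b<c)

skip-above : ∀ c r b → skip c r (c + b) ≡ c + (r + b)
skip-above zero r b = refl
skip-above (suc c) r b = cong suc (skip-above c r b)

pin-skip : ∀ c r b → pin c (skip c r b) ≡ skip c (suc r) b
pin-skip zero r b = refl
pin-skip (suc c) r zero = refl
pin-skip (suc c) r (suc b) = cong suc (pin-skip c r b)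

pin-≢ : ∀ c b → pin c b ≢ c
pin-≢ zero b ()
pin-≢ (suc c) zero ()
pin-≢ (suc c) (suc b) eq = pin-≢ c b (ℕP.suc-injective eq)

pin-injective : ∀ c b b' → pin c b ≡ pin c b' → b ≡ b'
pin-injective zero b b' eq = ℕP.suc-injective eq
pin-injective (suc c) zero zero eq = refl
pin-injective (suc c) (suc b) (suc b') eq = cong suc (pin-injective c b b' (ℕP.suc-injective eq))

pin-< : ∀ c b n → b < n → pin c b < suc n
pin-< zero b n b<n = s≤s b<n
pin-< (suc c) zero n _ = s≤s z≤n
pin-< (suc c) (suc b) (suc n) (s≤s b<n) = s≤s (pin-< c b n b<n)

unpin : ℕ → ℕ → ℕ
unpin zero c = pred c
unpin (suc l) zero = zero
unpin (suc l) (suc c) = suc (unpin l c)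

pin-unpin : ∀ l c → l ≢ c → pin l (unpin l c) ≡ c
pin-unpin zero zero l≢c = ⊥-elim (l≢c refl)
pin-unpin zero (suc c) _ = refl
pin-unpin (suc l) zero _ = refl
pin-unpin (suc l) (suc c) l≢c = cong suc (pin-unpin l c (l≢c ∘ cong suc))

unpin-< : ∀ n l c → l < suc n → c < suc n → l ≢ c → unpin l c < n
unpin-< n zero zero _ _ l≢c = ⊥-elim (l≢c refl)
unpin-< n zero (suc c) _ (s≤s c<n) _ = c<n
unpin-< zero (suc l) c (s≤s ()) _ _
unpin-< (suc n) (suc l) zero _ _ _ = s≤s z≤n
unpin-< (suc n) (suc l) (suc c) (s≤s l<n) (s≤s c<n) l≢c =
  s≤s (unpin-< n l c l<n c<n (l≢c ∘ cong suc))

unpin-suc : ∀ l c → l ≢ c → l ≢ suc c → unpin l (suc c) ≡ suc (unpin l c)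
unpin-suc zero zero l≢c _ = ⊥-elim (l≢c refl)
unpin-suc zero (suc c) _ _ = refl
unpin-suc (suc zero) zero _ l≢sc = ⊥-elim (l≢sc refl)
unpin-suc (suc (suc l)) zero _ _ = refl
unpin-suc (suc l) (suc c) l≢c l≢sc = cong suc (unpin-suc l c (l≢c ∘ cong suc) (l≢sc ∘ cong suc))

pin-adjacent : ∀ c b → b ≢ c → pin c b ≡ pin (suc c) b
pin-adjacent zero zero b≢c = ⊥-elim (b≢c refl)
pin-adjacent zero (suc b) _ = refl
pin-adjacent (suc c) zero _ = refl
pin-adjacent (suc c) (suc b) b≢c = cong suc (pin-adjacent c b (b≢c ∘ cong suc))

pin-self : ∀ c → pin c c ≡ suc c
pin-self zero = refl
pin-self (suc c) = cong suc (pin-self c)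

pin-suc-self : ∀ c → pin (suc c) c ≡ c
pin-suc-self zero = refl
pin-suc-self (suc c) = cong suc (pin-suc-self c)

pin-above : ∀ c x → c ≤ x → pin c x ≡ suc x
pin-above zero x _ = refl
pin-above (suc c) (suc x) (s≤s c≤x) = cong suc (pin-above c x c≤x)

Det-column-additive : ∀ n c (F G H : InfMat) → c < n →
  (∀ a b → b ≢ c → F a b ≡ G a b) → (∀ a b → b ≢ c → F a b ≡ H a b) →
  (∀ a → F a c ≡ G a c +ᶻ H a c) → Det n F ≡ Det n G +ᶻ Det n H
Det-column-additive zero c F G H () _ _ _
Det-column-additive (suc n) c F G H c<n F≈G F≈H F≡G+H = begin
    Det (suc n) F                                       ≡⟨ Det-expand n F ⟩
    ΣN (suc n) (rowTerm n F)                            ≡⟨ ΣN-cong (suc n) term ⟩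
    ΣN (suc n) (λ l → rowTerm n G l +ᶻ rowTerm n H l)   ≡⟨ ΣN-+ (suc n) (rowTerm n G) (rowTerm n H) ⟩
    ΣN (suc n) (rowTerm n G) +ᶻ ΣN (suc n) (rowTerm n H) ≡⟨ sym (cong₂ _+ᶻ_ (Det-expand n G) (Det-expand n H)) ⟩
    Det (suc n) G +ᶻ Det (suc n) H                      ∎
  where
  open ≡-Reasoning
  distribˡ : ∀ s x y d → (s *ᶻ (x +ᶻ y)) *ᶻ d ≡ (s *ᶻ x) *ᶻ d +ᶻ (s *ᶻ y) *ᶻ d
  distribˡ = solve-∀
  distribʳ : ∀ s x d e → (s *ᶻ x) *ᶻ (d +ᶻ e) ≡ (s *ᶻ x) *ᶻ d +ᶻ (s *ᶻ x) *ᶻ e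
  distribʳ = solve-∀
  -- deleting column c itself: the three minors coincide
  minors-equal : ∀ {A} → (∀ a b → b ≢ c → F a b ≡ A a b) → Det n (minor c F) ≡ Det n (minor c A)
  minors-equal F≈A = Det-cong n (λ a b _ _ → F≈A (suc a) (pin c b) (pin-≢ c b))
  term : ∀ l → l < suc n → rowTerm n F l ≡ rowTerm n G l +ᶻ rowTerm n H l
  term l l<n with l ≟ c
  ... | yes refl =
    trans (cong₂ (λ x d → (sgn l *ᶻ x) *ᶻ d) (F≡G+H 0) (minors-equal F≈G))
    (trans (distribˡ (sgn l) (G 0 l) (H 0 l) (Det n (minor l G)))
           (cong (λ d → (sgn l *ᶻ G 0 l) *ᶻ Det n (minor l G) +ᶻ (sgn l *ᶻ H 0 l) *ᶻ d)
                 (trans (sym (minors-equal F≈G)) (minors-equal F≈H))))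
  ... | no l≢c =
    trans (cong ((sgn l *ᶻ F 0 l) *ᶻ_) minor-additive)
    (trans (distribʳ (sgn l) (F 0 l) (Det n (minor l G)) (Det n (minor l H)))
           (cong₂ (λ x y → (sgn l *ᶻ x) *ᶻ Det n (minor l G) +ᶻ (sgn l *ᶻ y) *ᶻ Det n (minor l H))
                  (F≈G 0 l l≢c) (F≈H 0 l l≢c)))
    where
    -- in the minor, column c of F has become column unpin l c
    c' = unpin l c
    pin-c' = pin-unpin l c l≢c
    off : ∀ b → b ≢ c' → pin l b ≢ c
    off b b≢c' eq = b≢c' (pin-injective l b c' (trans eq (sym pin-c')))
    minor-additive : Det n (minor l F) ≡ Det n (minor l G) +ᶻ Det n (minor l H)
    minor-additive = Det-column-additive n c' (minor l F) (minor l G) (minor l H)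
      (unpin-< n l c l<n c<n l≢c)
      (λ a b b≢c' → F≈G (suc a) (pin l b) (off b b≢c'))
      (λ a b b≢c' → F≈H (suc a) (pin l b) (off b b≢c'))
      (λ a → trans (cong (F (suc a)) pin-c')
             (trans (F≡G+H (suc a)) (cong₂ _+ᶻ_ (cong (G (suc a)) (sym pin-c')) (cong (H (suc a)) (sym pin-c')))))

Det-equal-columns : ∀ n c (F : InfMat) → suc c < n → (∀ a → a < n → F a c ≡ F a (suc c)) → Det n F ≡ 0ℤ
Det-equal-columns zero c F () _
Det-equal-columns (suc n) c F sc<n cols = begin
    Det (suc n) F                           ≡⟨ Det-expand n F ⟩
    ΣN (suc n) (rowTerm n F)                ≡⟨ ΣN-pair (suc n) c (suc c) (rowTerm n F)
                                                 (ℕP.<-trans (ℕP.n<1+n c) sc<n) sc<n (ℕP.<⇒≢ (ℕP.n<1+n c)) others ⟩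
    rowTerm n F c +ᶻ rowTerm n F (suc c)    ≡⟨ cong₂ (λ x d → (sgn c *ᶻ x) *ᶻ d +ᶻ rowTerm n F (suc c))
                                                     (cols 0 (s≤s z≤n)) minors-equal ⟩
    (sgn c *ᶻ x) *ᶻ d +ᶻ ((- sgn c) *ᶻ x) *ᶻ d ≡⟨ cancel (sgn c) x d ⟩
    0ℤ                                      ∎
  where
  open ≡-Reasoning
  x = F 0 (suc c)
  d = Det n (minor (suc c) F)
  cancel : ∀ s x d → (s *ᶻ x) *ᶻ d +ᶻ ((- s) *ᶻ x) *ᶻ d ≡ 0ℤ
  cancel = solve-∀
  -- deleting either of the two equal columns gives the same minor
  minors-equal : Det n (minor c F) ≡ Det n (minor (suc c) F)
  minors-equal = Det-cong n same
    where
    same : ∀ a b → a < n → b < n → minor c F a b ≡ minor (suc c) F a b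
    same a b a<n _ with b ≟ c
    ... | yes refl = trans (cong (F (suc a)) (pin-self b))
                     (trans (sym (cols (suc a) (s≤s a<n))) (cong (F (suc a)) (sym (pin-suc-self b))))
    ... | no b≢c = cong (F (suc a)) (pin-adjacent c b b≢c)
  -- every other minor still has two equal adjacent columns
  others : ∀ l → l < suc n → l ≢ c → l ≢ suc c → rowTerm n F l ≡ 0ℤ
  others l l<n l≢c l≢sc = trans (cong ((sgn l *ᶻ F 0 l) *ᶻ_) minor-zero) (ℤP.*-zeroʳ (sgn l *ᶻ F 0 l))
    where
    c' = unpin l c
    pin-c' = pin-unpin l c l≢c
    pin-sc' : pin l (suc c') ≡ suc c
    pin-sc' = trans (cong (pin l) (sym (unpin-suc l c l≢c l≢sc))) (pin-unpin l (suc c) l≢sc)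
    sc'<n : suc c' < n
    sc'<n = subst (_< n) (unpin-suc l c l≢c l≢sc) (unpin-< n l (suc c) l<n sc<n l≢sc)
    minor-zero : Det n (minor l F) ≡ 0ℤ
    minor-zero = Det-equal-columns n c' (minor l F) sc'<n
      (λ a a<n → trans (cong (F (suc a)) pin-c') (trans (cols (suc a) (s≤s a<n)) (cong (F (suc a)) (sym pin-sc'))))

Det-add-column : ∀ n c (F G : InfMat) → suc c < n →
  (∀ a b → b ≢ suc c → G a b ≡ F a b) → (∀ a → G a (suc c) ≡ F a (suc c) +ᶻ F a c) →
  Det n G ≡ Det n F
Det-add-column n c F G sc<n G≈F G≡F+F =
  trans (Det-column-additive n (suc c) G F H sc<n G≈F G≈H G≡F+H)
        (trans (cong (Det n F +ᶻ_) H-zero) (ℤP.+-identityʳ _))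
  where
  collapse : ℕ → ℕ
  collapse b = if b ≡ᵇ suc c then c else b
  H : InfMat
  H a b = F a (collapse b)
  collapse-≢ : ∀ b → b ≢ suc c → collapse b ≡ b
  collapse-≢ b b≢sc = cong (λ t → if t then c else b) (≡ᵇ-≢ b≢sc)
  collapse-suc : collapse (suc c) ≡ c
  collapse-suc = cong (λ t → if t then c else suc c) (≡ᵇ-refl c)
  G≈H : ∀ a b → b ≢ suc c → G a b ≡ H a b
  G≈H a b b≢sc = trans (G≈F a b b≢sc) (cong (F a) (sym (collapse-≢ b b≢sc)))
  G≡F+H : ∀ a → G a (suc c) ≡ F a (suc c) +ᶻ H a (suc c)
  G≡F+H a = trans (G≡F+F a) (cong (λ x → F a (suc c) +ᶻ F a x) (sym collapse-suc))
  H-zero : Det n H ≡ 0ℤ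
  H-zero = Det-equal-columns n c H sc<n
    (λ a _ → trans (cong (F a) (collapse-≢ c (ℕP.<⇒≢ (ℕP.n<1+n c)))) (cong (F a) (sym collapse-suc)))

Det-row-single : ∀ n c (F : InfMat) → c < suc n → (∀ b → b < suc n → b ≢ c → F 0 b ≡ 0ℤ) →
  Det (suc n) F ≡ (sgn c *ᶻ F 0 c) *ᶻ Det n (minor c F)
Det-row-single n c F c<n zeros = trans (Det-expand n F)
  (ΣN-single (suc n) c (rowTerm n F) c<n (λ b b<n b≢c → rowTerm-zero n F b (zeros b b<n b≢c)))

Det-row-zero : ∀ n (F : InfMat) → (∀ b → b < suc n → F 0 b ≡ 0ℤ) → Det (suc n) F ≡ 0ℤ
Det-row-zero n F zeros =
  trans (Det-expand n F) (ΣN-zero (suc n) (λ b b<n → rowTerm-zero n F b (zeros b b<n)))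

Det-column-single : ∀ n (F : InfMat) → (∀ a → a < suc n → a ≢ 0 → F a 0 ≡ 0ℤ) →
  Det (suc n) F ≡ F 0 0 *ᶻ Det n (λ a b → F (suc a) (suc b))
Det-column-single n F zeros = begin
    Det (suc n) F                                        ≡⟨ sym (Det-transpose (suc n) F) ⟩
    Det (suc n) (λ a b → F b a)                          ≡⟨ Det-row-single n 0 (λ a b → F b a) (s≤s z≤n) zeros ⟩
    (1ℤ *ᶻ F 0 0) *ᶻ Det n (λ a b → F (suc b) (suc a))   ≡⟨ cong₂ _*ᶻ_ (ℤP.*-identityˡ (F 0 0))
                                                              (Det-transpose n (λ a b → F (suc a) (suc b))) ⟩
    F 0 0 *ᶻ Det n (λ a b → F (suc a) (suc b))           ∎
  where open ≡-Reasoning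

Det-equal-rows : ∀ n r (F : InfMat) → suc r < n → (∀ b → b < n → F r b ≡ F (suc r) b) → Det n F ≡ 0ℤ
Det-equal-rows n r F sr<n rows = trans (sym (Det-transpose n F)) (Det-equal-columns n r (λ a b → F b a) sr<n rows)

-- ε n is the sign of the order-reversing permutation of {0, …, n-1}.
ε : ℕ → ℤ
ε zero = 1ℤ
ε (suc n) = sgn n *ᶻ ε n

ε-square : ∀ n → ε n *ᶻ ε n ≡ 1ℤ
ε-square zero = refl
ε-square (suc n) = trans (regroup (sgn n) (ε n)) (cong₂ _*ᶻ_ (sgn-square n) (ε-square n))
  where
  regroup : ∀ s e → (s *ᶻ e) *ᶻ (s *ᶻ e) ≡ (s *ᶻ s) *ᶻ (e *ᶻ e)
  regroup = solve-∀

reverse-pin : ∀ n c b → c ≤ n → b < n → n ∸ pin c b ≡ pin (n ∸ c) (n ∸ suc b)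
reverse-pin n c b c≤n b<n with ℕP.<-cmp b c
... | tri< b<c _ _ = trans (cong (n ∸_) (skip-below c 1 b b<c))
      (sym (trans (pin-above (n ∸ c) (n ∸ suc b) (ℕP.∸-monoʳ-≤ n b<c)) (sym (ℕP.+-∸-assoc 1 b<n))))
... | tri≈ _ refl _ = trans (cong (n ∸_) (pin-above c b ℕP.≤-refl))
      (sym (skip-below (n ∸ c) 1 (n ∸ suc b) (ℕP.∸-monoʳ-< (ℕP.n<1+n b) b<n)))
... | tri> _ _ c<b = trans (cong (n ∸_) (pin-above c b (ℕP.<⇒≤ c<b)))
      (sym (skip-below (n ∸ c) 1 (n ∸ suc b) (ℕP.∸-monoʳ-< (ℕP.<-trans c<b (ℕP.n<1+n b)) b<n)))

Det-reverse-columns : ∀ n (F : InfMat) → Det n (λ a b → F a (n ∸ suc b)) ≡ ε n *ᶻ Det n F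
Det-reverse-columns zero F = refl
Det-reverse-columns (suc n) F = begin
    Det (suc n) (λ a b → F a (n ∸ b))
      ≡⟨ Det-expand n (λ a b → F a (n ∸ b)) ⟩
    ΣN (suc n) (λ c → (sgn c *ᶻ F 0 (n ∸ c)) *ᶻ Det n (λ a b → F (suc a) (n ∸ pin c b)))
      ≡⟨ ΣN-cong (suc n) term ⟩
    ΣN (suc n) (λ c → (sgn n *ᶻ ε n) *ᶻ rowTerm n F (n ∸ c))
      ≡⟨ ΣN-*ˡ (suc n) (sgn n *ᶻ ε n) (λ c → rowTerm n F (n ∸ c)) ⟩
    ε (suc n) *ᶻ ΣN (suc n) (λ c → rowTerm n F (n ∸ c))
      ≡⟨ cong (ε (suc n) *ᶻ_) (trans (ΣN-reverse n (rowTerm n F)) (sym (Det-expand n F))) ⟩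
    ε (suc n) *ᶻ Det (suc n) F ∎
  where
  open ≡-Reasoning
  regroup : ∀ sn sd x e d → ((sn *ᶻ sd) *ᶻ x) *ᶻ (e *ᶻ d) ≡ (sn *ᶻ e) *ᶻ ((sd *ᶻ x) *ᶻ d)
  regroup = solve-∀
  term : ∀ c → c < suc n →
    (sgn c *ᶻ F 0 (n ∸ c)) *ᶻ Det n (λ a b → F (suc a) (n ∸ pin c b)) ≡ (sgn n *ᶻ ε n) *ᶻ rowTerm n F (n ∸ c)
  term c (s≤s c≤n) =
    trans (cong₂ (λ s d → (s *ᶻ F 0 (n ∸ c)) *ᶻ d) (sgn-∸ c n c≤n)
            (trans (Det-cong n (λ a b _ b<n → cong (F (suc a)) (reverse-pin n c b c≤n b<n)))
                   (Det-reverse-columns n (minor (n ∸ c) F))))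
          (regroup (sgn n) (sgn (n ∸ c)) (F 0 (n ∸ c)) (ε n) (Det n (minor (n ∸ c) F)))

Det-reverse : ∀ n (F : InfMat) → Det n (λ a b → F (n ∸ suc a) (n ∸ suc b)) ≡ Det n F
Det-reverse n F = begin
    Det n (λ a b → F (n ∸ suc a) (n ∸ suc b)) ≡⟨ sym (Det-transpose n (λ a b → F (n ∸ suc a) (n ∸ suc b))) ⟩
    Det n (λ a b → F (n ∸ suc b) (n ∸ suc a)) ≡⟨ Det-reverse-columns n (λ a b → F b (n ∸ suc a)) ⟩
    ε n *ᶻ Det n (λ a b → F b (n ∸ suc a))    ≡⟨ cong (ε n *ᶻ_) (Det-transpose n (λ a b → F a (n ∸ suc b))) ⟩
    ε n *ᶻ Det n (λ a b → F a (n ∸ suc b))    ≡⟨ cong (ε n *ᶻ_) (Det-reverse-columns n F) ⟩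
    ε n *ᶻ (ε n *ᶻ Det n F)                   ≡⟨ sym (ℤP.*-assoc (ε n) (ε n) _) ⟩
    (ε n *ᶻ ε n) *ᶻ Det n F                   ≡⟨ cong (_*ᶻ Det n F) (ε-square n) ⟩
    1ℤ *ᶻ Det n F                             ≡⟨ ℤP.*-identityˡ _ ⟩
    Det n F                                   ∎
  where open ≡-Reasoning

skip-zero : ∀ c b → skip c 0 b ≡ b
skip-zero zero b = refl
skip-zero (suc c) zero = refl
skip-zero (suc c) (suc b) = cong suc (skip-zero c b)

pin-hits : ∀ c b i → pin c b ≡ c + suc i → b ≡ c + i
pin-hits zero b i eq = ℕP.suc-injective eq
pin-hits (suc c) (suc b) i eq = cong suc (pin-hits c b i (ℕP.suc-injective eq))

Det-peel-rows : ∀ r n c (F : InfMat) → c ≤ n →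
  (∀ i b → i < r → b < r + n → F i b ≡ δ b (c + i)) →
  Det (r + n) F ≡ sgn (r * c) *ᶻ Det n (λ a b → F (r + a) (skip c r b))
Det-peel-rows zero n c F _ _ =
  trans (Det-cong n (λ a b _ _ → cong (F a) (sym (skip-zero c b)))) (sym (ℤP.*-identityˡ _))
Det-peel-rows (suc r) n c F c≤n unitRows = begin
    Det (suc (r + n)) F
      ≡⟨ Det-row-single (r + n) c F c<r+n+1 off-c ⟩
    (sgn c *ᶻ F 0 c) *ᶻ Det (r + n) (minor c F)
      ≡⟨ cong₂ (λ x d → (sgn c *ᶻ x) *ᶻ d) (trans (unitRows 0 c (s≤s z≤n) c<r+n+1) (δ-≡ (sym (ℕP.+-identityʳ c))))
               (Det-peel-rows r n c (minor c F) c≤n unitRows′) ⟩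
    (sgn c *ᶻ 1ℤ) *ᶻ (sgn (r * c) *ᶻ Det n (λ a b → F (suc (r + a)) (pin c (skip c r b))))
      ≡⟨ cong (λ d → (sgn c *ᶻ 1ℤ) *ᶻ (sgn (r * c) *ᶻ d))
              (Det-cong n (λ a b _ _ → cong (F (suc (r + a))) (pin-skip c r b))) ⟩
    (sgn c *ᶻ 1ℤ) *ᶻ (sgn (r * c) *ᶻ Det n (λ a b → F (suc r + a) (skip c (suc r) b)))
      ≡⟨ trans (regroup (sgn c) (sgn (r * c)) D) (cong (_*ᶻ D) (sym (sgn-+ c (r * c)))) ⟩
    sgn (suc r * c) *ᶻ Det n (λ a b → F (suc r + a) (skip c (suc r) b)) ∎
  where
  open ≡-Reasoning
  regroup : ∀ s t d → (s *ᶻ 1ℤ) *ᶻ (t *ᶻ d) ≡ (s *ᶻ t) *ᶻ d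
  regroup = solve-∀
  D = Det n (λ a b → F (suc r + a) (skip c (suc r) b))
  c<r+n+1 : c < suc (r + n)
  c<r+n+1 = s≤s (ℕP.≤-trans c≤n (ℕP.m≤n+m n r))
  off-c : ∀ b → b < suc (r + n) → b ≢ c → F 0 b ≡ 0ℤ
  off-c b b<N b≢c = trans (unitRows 0 b (s≤s z≤n) b<N) (δ-≢ (λ eq → b≢c (trans eq (ℕP.+-identityʳ c))))
  unitRows′ : ∀ i b → i < r → b < r + n → minor c F i b ≡ δ b (c + i)
  unitRows′ i b i<r b<r+n =
    trans (unitRows (suc i) (pin c b) (s≤s i<r) (pin-< c b (r + n) b<r+n))
          (δ-iff (pin-hits c b i)
                 (λ { refl → trans (pin-above c (c + i) (ℕP.m≤m+n c i)) (sym (ℕP.+-suc c i)) }))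

Det-peel-columns : ∀ r n (F : InfMat) →
  (∀ a j → j < r → a < r + n → F a j ≡ δ a j) →
  Det (r + n) F ≡ Det n (λ a b → F (r + a) (r + b))
Det-peel-columns r n F unitColumns = begin
    Det (r + n) F                                           ≡⟨ sym (Det-transpose (r + n) F) ⟩
    Det (r + n) (λ a b → F b a)                             ≡⟨ Det-peel-rows r n 0 (λ a b → F b a) z≤n
                                                                 (λ i b i<r b<N → unitColumns b i i<r b<N) ⟩
    sgn (r * 0) *ᶻ Det n (λ a b → F (r + b) (r + a))        ≡⟨ cong₂ _*ᶻ_ (cong sgn (ℕP.*-zeroʳ r))
                                                                 (Det-transpose n (λ a b → F (r + a) (r + b))) ⟩
    1ℤ *ᶻ Det n (λ a b → F (r + a) (r + b))                 ≡⟨ ℤP.*-identityˡ _ ⟩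
    Det n (λ a b → F (r + a) (r + b))                       ∎
  where open ≡-Reasoning

withPrevColumn : InfMat → InfMat
withPrevColumn F a zero = F a zero
withPrevColumn F a (suc b) = F a (suc b) +ᶻ F a b

withPrevRow : InfMat → InfMat
withPrevRow F zero b = F zero b
withPrevRow F (suc a) b = F (suc a) b +ᶻ F a b

-- Intermediate stage: only the columns b ≥ t receive their predecessor.
withPrevColumnFrom : ℕ → InfMat → InfMat
withPrevColumnFrom t F a zero = F a zero
withPrevColumnFrom t F a (suc b) = if does (t ≤? suc b) then F a (suc b) +ᶻ F a b else F a (suc b)

module _ (F : InfMat) where

  private
    G : ℕ → InfMat
    G t = withPrevColumnFrom t F

    stages-agree : ∀ c a b → b ≢ suc c → G (suc c) a b ≡ G (suc (suc c)) a b
    stages-agree c a zero _ = refl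
    stages-agree c a (suc b) sb≢sc with ℕP.<-cmp b c
    ... | tri< b<c _ _ rewrite dec-false (suc c ≤? suc b) (ℕP.<⇒≱ (s≤s b<c))
                             | dec-false (suc (suc c) ≤? suc b) (ℕP.<⇒≱ (s≤s (ℕP.m<n⇒m<1+n b<c))) = refl
    ... | tri≈ _ refl _ = ⊥-elim (sb≢sc refl)
    ... | tri> _ _ c<b rewrite dec-true (suc c ≤? suc b) (s≤s (ℕP.<⇒≤ c<b))
                             | dec-true (suc (suc c) ≤? suc b) (s≤s c<b) = refl

    stage-column : ∀ c a → G (suc c) a (suc c) ≡ G (suc (suc c)) a (suc c) +ᶻ G (suc (suc c)) a c
    stage-column c a
      rewrite dec-true (suc c ≤? suc c) ℕP.≤-refl
            | dec-false (suc (suc c) ≤? suc c) (ℕP.<⇒≱ (ℕP.n<1+n (suc c))) = cong (F a (suc c) +ᶻ_) (unmodified c)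
      where
      unmodified : ∀ c → F a c ≡ G (suc (suc c)) a c
      unmodified zero = refl
      unmodified (suc c) rewrite dec-false (suc (suc (suc c)) ≤? suc c) (ℕP.<⇒≱ (ℕP.m<n⇒m<1+n (ℕP.n<1+n (suc c)))) = refl

    stage-step : ∀ n c → Det n (G (suc c)) ≡ Det n (G (suc (suc c)))
    stage-step n c with suc c <? n
    ... | yes sc<n = Det-add-column n c (G (suc (suc c))) (G (suc c)) sc<n (stages-agree c) (stage-column c)
    ... | no sc≮n = Det-cong n (λ a b _ b<n → stages-agree c a b (λ { refl → sc≮n b<n }))

    stages : ∀ n d → Det n (G 1) ≡ Det n (G (suc d))
    stages n zero = refl
    stages n (suc d) = trans (stages n d) (stage-step n d)

    first-stage : ∀ a b → G 1 a b ≡ withPrevColumn F a b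
    first-stage a zero = refl
    first-stage a (suc b) rewrite dec-true (1 ≤? suc b) (s≤s z≤n) = refl

    last-stage : ∀ n a b → b < n → G (suc n) a b ≡ F a b
    last-stage n a zero _ = refl
    last-stage n a (suc b) sb<n rewrite dec-false (suc n ≤? suc b) (ℕP.<⇒≱ (s≤s (ℕP.<⇒≤ sb<n))) = refl

  -- Adding to each column its predecessor, starting from the last one, is a
  -- sequence of determinant-preserving column operations.
  Det-withPrevColumn : ∀ n → Det n (withPrevColumn F) ≡ Det n F
  Det-withPrevColumn n =
    trans (Det-cong n (λ a b _ _ → sym (first-stage a b)))
    (trans (stages n n) (Det-cong n (λ a b _ b<n → last-stage n a b b<n)))

Det-withPrevRow : ∀ n (F : InfMat) → Det n (withPrevRow F) ≡ Det n F
Det-withPrevRow n F = begin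
    Det n (withPrevRow F)                          ≡⟨ sym (Det-transpose n (withPrevRow F)) ⟩
    Det n (λ a b → withPrevRow F b a)              ≡⟨ Det-cong n (λ a b _ _ → transposed a b) ⟩
    Det n (withPrevColumn (λ a b → F b a))         ≡⟨ Det-withPrevColumn (λ a b → F b a) n ⟩
    Det n (λ a b → F b a)                          ≡⟨ Det-transpose n F ⟩
    Det n F                                        ∎
  where
  open ≡-Reasoning
  transposed : ∀ a b → withPrevRow F b a ≡ withPrevColumn (λ a b → F b a) a b
  transposed a zero = refl
  transposed a (suc b) = refl

ev : ℤ → Poly → ℤ
ev x [] = 0ℤ
ev x (c ∷ p) = c +ᶻ x *ᶻ ev x p

ev-padd : ∀ x p q → ev x (padd p q) ≡ ev x p +ᶻ ev x q
ev-padd x [] q = sym (ℤP.+-identityˡ _)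
ev-padd x (a ∷ p) [] = sym (ℤP.+-identityʳ _)
ev-padd x (a ∷ p) (b ∷ q) =
  trans (cong (λ t → (a +ᶻ b) +ᶻ x *ᶻ t) (ev-padd x p q)) (regroup a b x (ev x p) (ev x q))
  where
  regroup : ∀ a b x u v → (a +ᶻ b) +ᶻ x *ᶻ (u +ᶻ v) ≡ (a +ᶻ x *ᶻ u) +ᶻ (b +ᶻ x *ᶻ v)
  regroup = solve-∀

ev-pscale : ∀ x c p → ev x (pscale c p) ≡ c *ᶻ ev x p
ev-pscale x c [] = sym (ℤP.*-zeroʳ c)
ev-pscale x c (a ∷ p) = trans (cong (λ t → c *ᶻ a +ᶻ x *ᶻ t) (ev-pscale x c p)) (regroup c a x (ev x p))
  where
  regroup : ∀ c a x u → c *ᶻ a +ᶻ x *ᶻ (c *ᶻ u) ≡ c *ᶻ (a +ᶻ x *ᶻ u)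
  regroup = solve-∀

ev-pmul : ∀ x p q → ev x (pmul p q) ≡ ev x p *ᶻ ev x q
ev-pmul x [] q = refl
ev-pmul x (a ∷ p) q = begin
    ev x (padd (pscale a q) (0ℤ ∷ pmul p q))          ≡⟨ ev-padd x (pscale a q) (0ℤ ∷ pmul p q) ⟩
    ev x (pscale a q) +ᶻ (0ℤ +ᶻ x *ᶻ ev x (pmul p q)) ≡⟨ cong₂ (λ u v → u +ᶻ (0ℤ +ᶻ x *ᶻ v))
                                                               (ev-pscale x a q) (ev-pmul x p q) ⟩
    a *ᶻ ev x q +ᶻ (0ℤ +ᶻ x *ᶻ (ev x p *ᶻ ev x q))    ≡⟨ regroup a x (ev x p) (ev x q) ⟩
    (a +ᶻ x *ᶻ ev x p) *ᶻ ev x q                      ∎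
  where
  open ≡-Reasoning
  regroup : ∀ a x u v → a *ᶻ v +ᶻ (0ℤ +ᶻ x *ᶻ (u *ᶻ v)) ≡ (a +ᶻ x *ᶻ u) *ᶻ v
  regroup = solve-∀

ev-pneg : ∀ x p → ev x (pneg p) ≡ - ev x p
ev-pneg x p = trans (ev-pscale x (- 1ℤ) p) (ℤP.-1*i≡-i (ev x p))

ev-pconst : ∀ x c → ev x (pconst c) ≡ c
ev-pconst x c = trans (cong (c +ᶻ_) (ℤP.*-zeroʳ x)) (ℤP.+-identityʳ c)

ev-pX : ∀ x → ev x pX ≡ x
ev-pX x = unfolded x
  where
  unfolded : ∀ x → 0ℤ +ᶻ x *ᶻ (1ℤ +ᶻ x *ᶻ 0ℤ) ≡ x
  unfolded = solve-∀

ev-sign : ∀ x n → ev x (sign PolyOps n) ≡ sgn n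
ev-sign x zero = ev-pconst x 1ℤ
ev-sign x (suc n) = trans (ev-pneg x (sign PolyOps n)) (cong -_ (ev-sign x n))

ev-sum : ∀ x {n} (f : Fin n → Poly) → ev x (sumFin PolyOps f) ≡ Σᶠ (λ i → ev x (f i))
ev-sum x {zero} f = refl
ev-sum x {suc n} f = trans (ev-padd x (f zero) _) (cong (ev x (f zero) +ᶻ_) (ev-sum x (f ∘ suc)))

ev-det : ∀ x {n} (M : SqMat Poly n) → ev x (det PolyOps M) ≡ detᶠ (λ i j → ev x (M i j))
ev-det x {zero} M = ev-pconst x 1ℤ
ev-det x {suc n} M =
  trans (ev-sum x (λ j → pmul (pmul (sign PolyOps (toℕ j)) (M zero j)) (minorDet j)))
        (Σᶠ-cong {suc n} λ j →
          trans (ev-pmul x (pmul (sign PolyOps (toℕ j)) (M zero j)) (minorDet j))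
                (cong₂ _*ᶻ_ (trans (ev-pmul x (sign PolyOps (toℕ j)) (M zero j))
                                   (cong (_*ᶻ ev x (M zero j)) (ev-sign x (toℕ j))))
                            (ev-det x (λ a b → M (suc a) (punchIn j b)))))
  where
  minorDet : Fin (suc n) → Poly
  minorDet j = det PolyOps (λ a b → M (suc a) (punchIn j b))

coeff : Poly → ℕ → ℤ
coeff [] i = 0ℤ
coeff (c ∷ p) zero = c
coeff (c ∷ p) (suc i) = coeff p i

coeff-padd : ∀ p q i → coeff (padd p q) i ≡ coeff p i +ᶻ coeff q i
coeff-padd [] q i = sym (ℤP.+-identityˡ _)
coeff-padd (a ∷ p) [] zero = sym (ℤP.+-identityʳ a)
coeff-padd (a ∷ p) [] (suc i) = sym (ℤP.+-identityʳ _)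
coeff-padd (a ∷ p) (b ∷ q) zero = refl
coeff-padd (a ∷ p) (b ∷ q) (suc i) = coeff-padd p q i

coeff-pscale : ∀ c p i → coeff (pscale c p) i ≡ c *ᶻ coeff p i
coeff-pscale c [] i = sym (ℤP.*-zeroʳ c)
coeff-pscale c (a ∷ p) zero = refl
coeff-pscale c (a ∷ p) (suc i) = coeff-pscale c p i

coeff-pneg : ∀ p i → coeff (pneg p) i ≡ - coeff p i
coeff-pneg p i = trans (coeff-pscale (- 1ℤ) p i) (ℤP.-1*i≡-i (coeff p i))

fixed-multiple : ∀ n k → n ≡ suc n * k → n ≡ 0
fixed-multiple n zero eq = trans eq (ℕP.*-zeroʳ (suc n))
fixed-multiple n (suc k) eq = ⊥-elim (ℕP.<-irrefl eq (ℕP.<-≤-trans (ℕP.n<1+n n) (ℕP.m≤m*n (suc n) (suc k))))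

-- For p = c + x q, taking x = |c| + 1 in
-- c = -x q(x) gives |c| = (|c| + 1) |q(x)|, so c = 0, and then q vanishes too.
coeffs-vanish : ∀ p → (∀ m → ev (+ suc m) p ≡ 0ℤ) → ∀ i → coeff p i ≡ 0ℤ
coeffs-vanish [] _ i = refl
coeffs-vanish (c ∷ p) vanishes = coeffs
  where
  c≡ : ∀ m → c ≡ - (+ suc m *ᶻ ev (+ suc m) p)
  c≡ m = trans (cancel c (+ suc m *ᶻ ev (+ suc m) p))
               (trans (cong (_+ᶻ - (+ suc m *ᶻ ev (+ suc m) p)) (vanishes m)) (ℤP.+-identityˡ _))
    where
    cancel : ∀ c y → c ≡ (c +ᶻ y) +ᶻ - y
    cancel = solve-∀
  c≡0 : c ≡ 0ℤ
  c≡0 = ℤP.∣i∣≡0⇒i≡0 (fixed-multiple ∣ c ∣ ∣ ev (+ suc ∣ c ∣) p ∣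
          (trans (cong ∣_∣ (c≡ ∣ c ∣))
                 (trans (ℤP.∣-i∣≡∣i∣ (+ suc ∣ c ∣ *ᶻ ev (+ suc ∣ c ∣) p))
                        (ℤP.abs-* (+ suc ∣ c ∣) (ev (+ suc ∣ c ∣) p)))))
  p-vanishes : ∀ m → ev (+ suc m) p ≡ 0ℤ
  p-vanishes m = ℤP.*-cancelˡ-≡ (+ suc m) (ev (+ suc m) p) 0ℤ
    (trans (sym (ℤP.+-identityˡ _))
    (trans (cong (_+ᶻ (+ suc m *ᶻ ev (+ suc m) p)) (sym c≡0))
    (trans (vanishes m) (sym (ℤP.*-zeroʳ (+ suc m))))))
  coeffs : ∀ i → coeff (c ∷ p) i ≡ 0ℤ
  coeffs zero = c≡0
  coeffs (suc i) = coeffs-vanish p p-vanishes i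

coeff-ext : ∀ p q → (∀ x → ev x p ≡ ev x q) → ∀ i → coeff p i ≡ coeff q i
coeff-ext p q same i = ℤP.i-j≡0⇒i≡j _ _
  (trans (sym (trans (coeff-padd p (pneg q) i) (cong (coeff p i +ᶻ_) (coeff-pneg q i))))
         (coeffs-vanish (padd p (pneg q)) difference-vanishes i))
  where
  difference-vanishes : ∀ m → ev (+ suc m) (padd p (pneg q)) ≡ 0ℤ
  difference-vanishes m =
    trans (ev-padd _ p (pneg q))
    (trans (cong₂ _+ᶻ_ (same (+ suc m)) (ev-pneg _ q)) (ℤP.+-inverseʳ (ev (+ suc m) q)))

sumBelow-cong : ∀ n {f h : ℕ → ℤ} → (∀ i → f i ≡ h i) → sumBelow n f ≡ sumBelow n h
sumBelow-cong zero e = refl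
sumBelow-cong (suc n) e = cong₂ _+ᶻ_ (sumBelow-cong n e) (e n)

sumBelow-+ : ∀ n (f h : ℕ → ℤ) → sumBelow n (λ i → f i +ᶻ h i) ≡ sumBelow n f +ᶻ sumBelow n h
sumBelow-+ zero f h = refl
sumBelow-+ (suc n) f h =
  trans (cong (_+ᶻ (f n +ᶻ h n)) (sumBelow-+ n f h)) (interchange (sumBelow n f) (sumBelow n h) (f n) (h n))
  where
  interchange : ∀ a b c d → (a +ᶻ b) +ᶻ (c +ᶻ d) ≡ (a +ᶻ c) +ᶻ (b +ᶻ d)
  interchange = solve-∀

sumBelow-neg : ∀ n (f : ℕ → ℤ) → sumBelow n (λ i → - f i) ≡ - sumBelow n f
sumBelow-neg zero f = refl
sumBelow-neg (suc n) f =
  trans (cong (_+ᶻ - f n) (sumBelow-neg n f)) (sym (ℤP.neg-distrib-+ (sumBelow n f) (f n)))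

sumBelow-zero : ∀ n (f : ℕ → ℤ) → (∀ i → i < n → f i ≡ 0ℤ) → sumBelow n f ≡ 0ℤ
sumBelow-zero zero f e = refl
sumBelow-zero (suc n) f e =
  cong₂ _+ᶻ_ (sumBelow-zero n f (λ i i<n → e i (ℕP.m<n⇒m<1+n i<n))) (e n (ℕP.n<1+n n))

γmul-cong : ∀ {B B′ : InfMat} → (∀ a b → B a b ≡ B′ a b) → ∀ a b → γmul B a b ≡ γmul B′ a b
γmul-cong e a b = sumBelow-cong (suc (suc a)) (λ l → cong (γ a l *ᶻ_) (e l b))

γmul-+ : ∀ (B B′ : InfMat) a b → γmul (λ i j → B i j +ᶻ B′ i j) a b ≡ γmul B a b +ᶻ γmul B′ a b
γmul-+ B B′ a b =
  trans (sumBelow-cong (suc (suc a)) (λ l → ℤP.*-distribˡ-+ (γ a l) (B l b) (B′ l b)))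
        (sumBelow-+ (suc (suc a)) (λ l → γ a l *ᶻ B l b) (λ l → γ a l *ᶻ B′ l b))

γmul-neg : ∀ (B : InfMat) a b → γmul (λ i j → - B i j) a b ≡ - γmul B a b
γmul-neg B a b =
  trans (sumBelow-cong (suc (suc a)) (λ l → sym (ℤP.neg-distribʳ-* (γ a l) (B l b))))
        (sumBelow-neg (suc (suc a)) (λ l → γ a l *ᶻ B l b))

γmul-zero : ∀ (B : InfMat) → (∀ i j → B i j ≡ 0ℤ) → ∀ a b → γmul B a b ≡ 0ℤ
γmul-zero B e a b =
  sumBelow-zero (suc (suc a)) _ (λ l _ → trans (cong (γ a l *ᶻ_) (e l b)) (ℤP.*-zeroʳ (γ a l)))

evalγ-zero : ∀ p → (∀ i → coeff p i ≡ 0ℤ) → ∀ a b → evalγ p a b ≡ 0ℤ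
evalγ-zero [] _ a b = refl
evalγ-zero (c ∷ p) zeros a b =
  cong₂ _+ᶻ_ (cong (_*ᶻ idInf a b) (zeros 0)) (γmul-zero (evalγ p) (evalγ-zero p (zeros ∘ suc)) a b)

-- p(γ) depends only on the coefficients of p (lists may differ by trailing zeros).
evalγ-ext : ∀ p q → (∀ i → coeff p i ≡ coeff q i) → ∀ a b → evalγ p a b ≡ evalγ q a b
evalγ-ext [] q same a b = sym (evalγ-zero q (λ i → sym (same i)) a b)
evalγ-ext (c ∷ p) [] same a b = evalγ-zero (c ∷ p) same a b
evalγ-ext (c ∷ p) (d ∷ q) same a b =
  cong₂ _+ᶻ_ (cong (_*ᶻ idInf a b) (same 0)) (γmul-cong (evalγ-ext p q (same ∘ suc)) a b)

evalγ-padd : ∀ p q a b → evalγ (padd p q) a b ≡ evalγ p a b +ᶻ evalγ q a b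
evalγ-padd [] q a b = sym (ℤP.+-identityˡ _)
evalγ-padd (c ∷ p) [] a b = sym (ℤP.+-identityʳ _)
evalγ-padd (c ∷ p) (d ∷ q) a b =
  trans (cong ((c +ᶻ d) *ᶻ idInf a b +ᶻ_) (trans (γmul-cong (evalγ-padd p q) a b) (γmul-+ (evalγ p) (evalγ q) a b)))
        (regroup c d (idInf a b) _ _)
  where
  regroup : ∀ c d i u v → (c +ᶻ d) *ᶻ i +ᶻ (u +ᶻ v) ≡ (c *ᶻ i +ᶻ u) +ᶻ (d *ᶻ i +ᶻ v)
  regroup = solve-∀

evalγ-pneg : ∀ p a b → evalγ (pneg p) a b ≡ - evalγ p a b
evalγ-pneg [] a b = refl
evalγ-pneg (c ∷ p) a b =
  trans (cong ((- 1ℤ *ᶻ c) *ᶻ idInf a b +ᶻ_) (trans (γmul-cong (evalγ-pneg p) a b) (γmul-neg (evalγ p) a b)))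
        (regroup c (idInf a b) (γmul (evalγ p) a b))
  where
  regroup : ∀ c i u → (- 1ℤ *ᶻ c) *ᶻ i +ᶻ - u ≡ - (c *ᶻ i +ᶻ u)
  regroup = solve-∀

charMat : ℤ → InfMat
charMat x a b = (if a ≡ᵇ b then x else 0ℤ) +ᶻ - γ a b

ev-g : ∀ x n → ev x (g n) ≡ Det n (charMat x)
ev-g x n = trans (ev-det x {n} _) (detᶠ-cong {n} λ i j → entry (toℕ i ≡ᵇ toℕ j) (γ (toℕ i) (toℕ j)))
  where
  diagonal : ∀ d → ev x (if d then pX else []) ≡ (if d then x else 0ℤ)
  diagonal false = refl
  diagonal true = ev-pX x
  entry : ∀ d c → ev x (padd (if d then pX else []) (pneg (pconst c))) ≡ (if d then x else 0ℤ) +ᶻ - c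
  entry d c = trans (ev-padd x (if d then pX else []) (pneg (pconst c)))
                    (cong₂ _+ᶻ_ (diagonal d) (trans (ev-pneg x (pconst c)) (cong -_ (ev-pconst x c))))

Det-tridiagonal : ∀ n (T : InfMat) → (∀ b → 2 ≤ b → T 0 b ≡ 0ℤ) → (∀ a → 2 ≤ a → T a 0 ≡ 0ℤ) →
  Det (suc (suc n)) T ≡ T 0 0 *ᶻ Det (suc n) (λ a b → T (suc a) (suc b))
                        +ᶻ - ((T 0 1 *ᶻ T 1 0) *ᶻ Det n (λ a b → T (suc (suc a)) (suc (suc b))))
Det-tridiagonal n T row0 column0 = begin
    Det (suc (suc n)) T
      ≡⟨ Det-expand (suc n) T ⟩
    ΣN (suc (suc n)) (rowTerm (suc n) T)
      ≡⟨ ΣN-pair (suc (suc n)) 0 1 (rowTerm (suc n) T) (s≤s z≤n) (s≤s (s≤s z≤n)) (λ ())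
           (λ { zero _ 0≢0 _ → ⊥-elim (0≢0 refl) ; (suc zero) _ _ 1≢1 → ⊥-elim (1≢1 refl)
              ; (suc (suc i)) _ _ _ → rowTerm-zero (suc n) T (suc (suc i)) (row0 (suc (suc i)) (s≤s (s≤s z≤n))) }) ⟩
    rowTerm (suc n) T 0 +ᶻ rowTerm (suc n) T 1
      ≡⟨ cong₂ _+ᶻ_ (cong (_*ᶻ Det (suc n) (λ a b → T (suc a) (suc b))) (ℤP.*-identityˡ (T 0 0)))
           (cong ((- 1ℤ *ᶻ T 0 1) *ᶻ_) (Det-column-single n (minor 1 T)
             (λ { zero _ 0≢0 → ⊥-elim (0≢0 refl) ; (suc a) _ _ → column0 (suc (suc a)) (s≤s (s≤s z≤n)) }))) ⟩
    T 0 0 *ᶻ D₁ +ᶻ (- 1ℤ *ᶻ T 0 1) *ᶻ (T 1 0 *ᶻ D₂)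
      ≡⟨ cong (T 0 0 *ᶻ D₁ +ᶻ_) (regroup (T 0 1) (T 1 0) D₂) ⟩
    T 0 0 *ᶻ D₁ +ᶻ - ((T 0 1 *ᶻ T 1 0) *ᶻ D₂) ∎
  where
  open ≡-Reasoning
  D₁ = Det (suc n) (λ a b → T (suc a) (suc b))
  D₂ = Det n (λ a b → T (suc (suc a)) (suc (suc b)))
  regroup : ∀ u v d → (- 1ℤ *ᶻ u) *ᶻ (v *ᶻ d) ≡ - ((u *ᶻ v) *ᶻ d)
  regroup = solve-∀

module _ (x : ℤ) where

  private
    -- U n is det (x I - γ) on the rows and columns 1, …, n, where γ has no
    -- loop, so U satisfies the Chebyshev recurrence; U₋ shifts it by one, with
    -- U₋ 0 = 0 in the role of U (-1).
    U : ℕ → ℤ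
    U n = Det n (λ a b → charMat x (suc a) (suc b))

    U₋ : ℕ → ℤ
    U₋ zero = 0ℤ
    U₋ (suc n) = U n

    D : ℕ → ℤ
    D n = Det n (charMat x)

    tridiagonal-row0 : ∀ b → 2 ≤ b → charMat x 0 b ≡ 0ℤ
    tridiagonal-row0 (suc zero) (s≤s ())
    tridiagonal-row0 (suc (suc b)) _ = refl
    tridiagonal-column0 : ∀ a → 2 ≤ a → charMat x a 0 ≡ 0ℤ
    tridiagonal-column0 (suc zero) (s≤s ())
    tridiagonal-column0 (suc (suc a)) _ = refl
    tridiagonal-row1 : ∀ b → 2 ≤ b → charMat x 1 (suc b) ≡ 0ℤ
    tridiagonal-row1 (suc zero) (s≤s ())
    tridiagonal-row1 (suc (suc b)) _ = refl
    tridiagonal-column1 : ∀ a → 2 ≤ a → charMat x (suc a) 1 ≡ 0ℤ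
    tridiagonal-column1 (suc zero) (s≤s ())
    tridiagonal-column1 (suc (suc a)) _ = refl

    U₋-rec : ∀ m → U₋ (suc (suc m)) ≡ x *ᶻ U₋ (suc m) +ᶻ - U₋ m
    U₋-rec zero = unfolded x
      where
      unfolded : ∀ x → (1ℤ *ᶻ (x +ᶻ - 0ℤ)) *ᶻ 1ℤ +ᶻ 0ℤ ≡ x *ᶻ 1ℤ +ᶻ - 0ℤ
      unfolded = solve-∀
    U₋-rec (suc m) =
      trans (Det-tridiagonal m (λ a b → charMat x (suc a) (suc b)) tridiagonal-row1 tridiagonal-column1)
            (cong₂ (λ u v → u *ᶻ U (suc m) +ᶻ - v) (ℤP.+-identityʳ x) (ℤP.*-identityˡ (U m)))

    D-via-U : ∀ m → D (suc m) ≡ (x +ᶻ - 1ℤ) *ᶻ U₋ (suc m) +ᶻ - U₋ m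
    D-via-U zero = unfolded x
      where
      unfolded : ∀ x → (1ℤ *ᶻ (x +ᶻ - 1ℤ)) *ᶻ 1ℤ +ᶻ 0ℤ ≡ (x +ᶻ - 1ℤ) *ᶻ 1ℤ +ᶻ - 0ℤ
      unfolded = solve-∀
    D-via-U (suc m) =
      trans (Det-tridiagonal m (charMat x) tridiagonal-row0 tridiagonal-column0)
            (cong (λ v → (x +ᶻ - 1ℤ) *ᶻ U (suc m) +ᶻ - v) (ℤP.*-identityˡ (U m)))

  -- g (n + 1) = x g n - g (n - 1), with the convention g (-1) = g 0.
  D-rec : ∀ n → Det (suc n) (charMat x) ≡ x *ᶻ Det n (charMat x) +ᶻ - Det (pred n) (charMat x)
  D-rec zero = trans (D-via-U 0) (unfolded x)
    where
    unfolded : ∀ x → (x +ᶻ - 1ℤ) *ᶻ 1ℤ +ᶻ - 0ℤ ≡ x *ᶻ 1ℤ +ᶻ - 1ℤ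
    unfolded = solve-∀
  D-rec (suc zero) = begin
      D 2                                       ≡⟨ D-via-U 1 ⟩
      (x +ᶻ - 1ℤ) *ᶻ U₋ 2 +ᶻ - U₋ 1             ≡⟨ cong (λ u → (x +ᶻ - 1ℤ) *ᶻ u +ᶻ - U₋ 1) (U₋-rec 0) ⟩
      (x +ᶻ - 1ℤ) *ᶻ (x *ᶻ 1ℤ +ᶻ - 0ℤ) +ᶻ - 1ℤ ≡⟨ unfolded x ⟩
      x *ᶻ ((x +ᶻ - 1ℤ) *ᶻ 1ℤ +ᶻ - 0ℤ) +ᶻ - 1ℤ ≡⟨ cong (λ d → x *ᶻ d +ᶻ - 1ℤ) (sym (D-via-U 0)) ⟩
      x *ᶻ D 1 +ᶻ - D 0                         ∎
    where
    open ≡-Reasoning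
    unfolded : ∀ x → (x +ᶻ - 1ℤ) *ᶻ (x *ᶻ 1ℤ +ᶻ - 0ℤ) +ᶻ - 1ℤ
                   ≡ x *ᶻ ((x +ᶻ - 1ℤ) *ᶻ 1ℤ +ᶻ - 0ℤ) +ᶻ - 1ℤ
    unfolded = solve-∀
  D-rec (suc (suc m)) = begin
      D (3 + m)
        ≡⟨ D-via-U (2 + m) ⟩
      (x +ᶻ - 1ℤ) *ᶻ U₋ (3 + m) +ᶻ - U₋ (2 + m)
        ≡⟨ cong₂ (λ u v → (x +ᶻ - 1ℤ) *ᶻ u +ᶻ - v) (U₋-rec (suc m)) (U₋-rec m) ⟩
      (x +ᶻ - 1ℤ) *ᶻ (x *ᶻ U₋ (2 + m) +ᶻ - U₋ (1 + m)) +ᶻ - (x *ᶻ U₋ (1 + m) +ᶻ - U₋ m)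
        ≡⟨ recombine x (U₋ (2 + m)) (U₋ (1 + m)) (U₋ m) ⟩
      x *ᶻ ((x +ᶻ - 1ℤ) *ᶻ U₋ (2 + m) +ᶻ - U₋ (1 + m)) +ᶻ - ((x +ᶻ - 1ℤ) *ᶻ U₋ (1 + m) +ᶻ - U₋ m)
        ≡⟨ sym (cong₂ (λ u v → x *ᶻ u +ᶻ - v) (D-via-U (suc m)) (D-via-U m)) ⟩
      x *ᶻ D (2 + m) +ᶻ - D (1 + m) ∎
    where
    open ≡-Reasoning
    recombine : ∀ x a b c → (x +ᶻ - 1ℤ) *ᶻ (x *ᶻ a +ᶻ - b) +ᶻ - (x *ᶻ b +ᶻ - c)
                          ≡ x *ᶻ ((x +ᶻ - 1ℤ) *ᶻ a +ᶻ - b) +ᶻ - ((x +ᶻ - 1ℤ) *ᶻ b +ᶻ - c)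
    recombine = solve-∀

g-rec : ∀ n i → coeff (g (suc n)) i ≡ coeff (padd (0ℤ ∷ g n) (pneg (g (pred n)))) i
g-rec n = coeff-ext (g (suc n)) (padd (0ℤ ∷ g n) (pneg (g (pred n)))) λ x →
  trans (ev-g x (suc n))
  (trans (D-rec x n)
  (sym (trans (ev-padd x (0ℤ ∷ g n) (pneg (g (pred n))))
              (cong₂ _+ᶻ_ (trans (ℤP.+-identityˡ (x *ᶻ ev x (g n))) (cong (x *ᶻ_) (ev-g x n)))
                          (trans (ev-pneg x (g (pred n))) (cong -_ (ev-g x (pred n))))))))

evalγ-g-rec : ∀ n a b → evalγ (g (suc n)) a b ≡ γmul (evalγ (g n)) a b +ᶻ - evalγ (g (pred n)) a b
evalγ-g-rec n a b =
  trans (evalγ-ext (g (suc n)) (padd (0ℤ ∷ g n) (pneg (g (pred n)))) (g-rec n) a b)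
  (trans (evalγ-padd (0ℤ ∷ g n) (pneg (g (pred n))) a b)
         (cong₂ _+ᶻ_ (ℤP.+-identityˡ (γmul (evalγ (g n)) a b)) (evalγ-pneg (g (pred n)) a b)))

-- laurent k n = (-1)^(k+n) for n ≤ k and 0 for n > k: with x = t + t⁻¹ one
-- has g k (x) = Σ_{|j| ≤ k} laurent k |j| · t^j.
laurent : ℕ → ℕ → ℤ
laurent zero zero = 1ℤ
laurent zero (suc n) = 0ℤ
laurent (suc k) zero = - laurent k zero
laurent (suc k) (suc n) = laurent k n

dist : ℕ → ℕ → ℕ
dist zero b = b
dist (suc a) zero = suc a
dist (suc a) (suc b) = dist a b

dist-zeroʳ : ∀ a → dist a 0 ≡ a
dist-zeroʳ zero = refl
dist-zeroʳ (suc a) = refl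

-- The folding of g k (S + S⁻¹) (S the shift on ℤ) under the reflection
-- i ↦ -1-i, which identifies γ with S + S⁻¹ on ℕ.
closedForm : ℕ → InfMat
closedForm k a b = laurent k (dist a b) +ᶻ laurent k (suc (a + b))

-- The coefficients obey the recurrence of g: multiplying by t + t⁻¹ shifts them.
laurent-rec : ∀ k n → laurent (suc k) (suc n) ≡ laurent k n +ᶻ laurent k (suc (suc n)) +ᶻ - laurent (pred k) (suc n)
laurent-rec zero n = sym (unfolded (laurent 0 n))
  where
  unfolded : ∀ x → x +ᶻ 0ℤ +ᶻ - 0ℤ ≡ x
  unfolded = solve-∀
laurent-rec (suc k) n = sym (cancel (laurent (suc k) n) (laurent k (suc n)))
  where
  cancel : ∀ a b → a +ᶻ b +ᶻ - b ≡ a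
  cancel = solve-∀

-- The same recurrence at the reflected index 0, where t^0 receives
-- contributions from t^{±1}.
laurent-rec₀ : ∀ k → laurent (suc k) 0 ≡ laurent k 1 +ᶻ laurent k 1 +ᶻ - laurent (pred k) 0
laurent-rec₀ zero = refl
laurent-rec₀ (suc k) = sym (unfolded (laurent k 0))
  where
  unfolded : ∀ a → a +ᶻ a +ᶻ - a ≡ - (- a)
  unfolded = solve-∀

laurent-dist-rec : ∀ k a b →
  laurent (suc k) (dist (suc a) b) ≡ laurent k (dist a b) +ᶻ laurent k (dist (suc (suc a)) b) +ᶻ - laurent (pred k) (dist (suc a) b)
laurent-dist-rec k a zero =
  trans (laurent-rec k a) (cong (λ t → laurent k t +ᶻ laurent k (suc (suc a)) +ᶻ - laurent (pred k) (suc a)) (sym (dist-zeroʳ a)))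
laurent-dist-rec k zero (suc zero) = laurent-rec₀ k
laurent-dist-rec k zero (suc (suc b)) =
  trans (laurent-rec k b) (swap (laurent k b) (laurent k (suc (suc b))) (laurent (pred k) (suc b)))
  where
  swap : ∀ x y z → x +ᶻ y +ᶻ - z ≡ y +ᶻ x +ᶻ - z
  swap = solve-∀
laurent-dist-rec k (suc a) (suc b) = laurent-dist-rec k a b

γ-below : ∀ a l → l < a → γ (suc a) l ≡ 0ℤ
γ-below a l l<a rewrite ≡ᵇ-≢ {suc (suc a)} {l} (λ eq → ℕP.<-asym l<a (subst (a <_) eq (ℕP.m<n⇒m<1+n (ℕP.n<1+n a))))
                      | ≡ᵇ-≢ {l} {a} (ℕP.<⇒≢ l<a) = refl

γ-left : ∀ a → γ (suc a) a ≡ 1ℤ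
γ-left a rewrite ≡ᵇ-≢ {suc (suc a)} {a} (λ eq → ℕP.<⇒≢ (ℕP.m<n⇒m<1+n (ℕP.n<1+n a)) (sym eq))
               | ≡ᵇ-refl a = refl

γ-diagonal : ∀ a → γ (suc a) (suc a) ≡ 0ℤ
γ-diagonal a rewrite ≡ᵇ-≢ {suc a} {a} (λ eq → ℕP.<⇒≢ (ℕP.n<1+n a) (sym eq)) = refl

γ-right : ∀ a → γ (suc a) (suc (suc a)) ≡ 1ℤ
γ-right a rewrite ≡ᵇ-refl (suc (suc a)) = refl

γmul-row0 : ∀ (B : InfMat) b → γmul B 0 b ≡ B 0 b +ᶻ B 1 b
γmul-row0 B b = unfolded (B 0 b) (B 1 b)
  where
  unfolded : ∀ x y → (0ℤ +ᶻ 1ℤ *ᶻ x) +ᶻ 1ℤ *ᶻ y ≡ x +ᶻ y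
  unfolded = solve-∀

γmul-row : ∀ (B : InfMat) a b → γmul B (suc a) b ≡ B a b +ᶻ B (suc (suc a)) b
γmul-row B a b = begin
    ((sumBelow a f +ᶻ f a) +ᶻ f (suc a)) +ᶻ f (suc (suc a))
      ≡⟨ cong₂ (λ u v → ((u +ᶻ f a) +ᶻ f (suc a)) +ᶻ v)
               (sumBelow-zero a f (λ l l<a → cong (_*ᶻ B l b) (γ-below a l l<a)))
               (cong (_*ᶻ B (suc (suc a)) b) (γ-right a)) ⟩
    ((0ℤ +ᶻ f a) +ᶻ f (suc a)) +ᶻ 1ℤ *ᶻ B (suc (suc a)) b
      ≡⟨ cong₂ (λ u v → ((0ℤ +ᶻ u *ᶻ B a b) +ᶻ v *ᶻ B (suc a) b) +ᶻ 1ℤ *ᶻ B (suc (suc a)) b)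
               (γ-left a) (γ-diagonal a) ⟩
    ((0ℤ +ᶻ 1ℤ *ᶻ B a b) +ᶻ 0ℤ *ᶻ B (suc a) b) +ᶻ 1ℤ *ᶻ B (suc (suc a)) b
      ≡⟨ unfolded (B a b) (B (suc a) b) (B (suc (suc a)) b) ⟩
    B a b +ᶻ B (suc (suc a)) b ∎
  where
  open ≡-Reasoning
  f : ℕ → ℤ
  f l = γ (suc a) l *ᶻ B l b
  unfolded : ∀ x y z → ((0ℤ +ᶻ 1ℤ *ᶻ x) +ᶻ 0ℤ *ᶻ y) +ᶻ 1ℤ *ᶻ z ≡ x +ᶻ z
  unfolded = solve-∀

closedForm-rec : ∀ k a b → closedForm (suc k) a b ≡ γmul (closedForm k) a b +ᶻ - closedForm (pred k) a b
closedForm-rec k zero b =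
  trans (cong₂ _+ᶻ_ (first b) (laurent-rec k b))
  (trans (regroup (laurent k (dist 1 b)) (laurent k (suc b)) (laurent (pred k) b)
                  (laurent k b) (laurent k (suc (suc b))) (laurent (pred k) (suc b)))
         (cong (_+ᶻ - closedForm (pred k) 0 b) (sym (γmul-row0 (closedForm k) b))))
  where
  first : ∀ b → laurent (suc k) b ≡ laurent k (dist 1 b) +ᶻ laurent k (suc b) +ᶻ - laurent (pred k) b
  first zero = laurent-rec₀ k
  first (suc b) = laurent-rec k b
  regroup : ∀ a₁ a₂ a₃ b₁ b₂ b₃ →
    (a₁ +ᶻ a₂ +ᶻ - a₃) +ᶻ (b₁ +ᶻ b₂ +ᶻ - b₃) ≡ ((b₁ +ᶻ a₂) +ᶻ (a₁ +ᶻ b₂)) +ᶻ - (a₃ +ᶻ b₃)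
  regroup = solve-∀
closedForm-rec k (suc a) b =
  trans (cong₂ _+ᶻ_ (laurent-dist-rec k a b) (laurent-rec k (suc (a + b))))
  (trans (regroup (laurent k (dist a b)) (laurent k (dist (suc (suc a)) b)) (laurent (pred k) (dist (suc a) b))
                  (laurent k (suc (a + b))) (laurent k (suc (suc (suc (a + b))))) (laurent (pred k) (suc (suc (a + b)))))
         (cong (_+ᶻ - closedForm (pred k) (suc a) b) (sym (γmul-row (closedForm k) a b))))
  where
  regroup : ∀ a₁ a₂ a₃ b₁ b₂ b₃ →
    (a₁ +ᶻ a₂ +ᶻ - a₃) +ᶻ (b₁ +ᶻ b₂ +ᶻ - b₃) ≡ ((a₁ +ᶻ b₁) +ᶻ (a₂ +ᶻ b₂)) +ᶻ - (a₃ +ᶻ b₃)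
  regroup = solve-∀

evalγ-g0 : ∀ a b → evalγ (g 0) a b ≡ closedForm 0 a b
evalγ-g0 a b = trans (cong₂ _+ᶻ_ (ℤP.*-identityˡ (idInf a b)) (γmul-zero (evalγ []) (λ _ _ → refl) a b))
                     (trans (ℤP.+-identityʳ (idInf a b)) (identity a b))
  where
  identity : ∀ a b → idInf a b ≡ closedForm 0 a b
  identity zero zero = refl
  identity zero (suc b) = refl
  identity (suc a) zero = refl
  identity (suc a) (suc b) = identity a b

evalγ-g : ∀ k a b → evalγ (g k) a b ≡ closedForm k a b
evalγ-g k = proj₁ (consecutive k)
  where
  Closed : ℕ → Set
  Closed k = ∀ a b → evalγ (g k) a b ≡ closedForm k a b
  step : ∀ k → Closed k → Closed (pred k) → Closed (suc k)
  step k ih ih₋ a b = trans (evalγ-g-rec k a b)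
    (trans (cong₂ (λ u v → u +ᶻ - v) (γmul-cong ih a b) (ih₋ a b)) (sym (closedForm-rec k a b)))
  consecutive : ∀ k → Closed k × Closed (suc k)
  consecutive zero = evalγ-g0 , step 0 evalγ-g0 evalγ-g0
  consecutive (suc k) = let (ih , ih₊) = consecutive k in ih₊ , step (suc k) ih₊ ih

-- Adding to each row of closedForm k its predecessor telescopes the
-- coefficients into the 0/1 matrix B k: row 0 is the unit row e_k, and
-- row a ≥ 1 is the sum of an anti-diagonal term (a one at column k - a, if
-- a ≤ k), a left term (column a - k - 1, if a > k) and a right term (a + k).
B : ℕ → InfMat
B k zero b = δ b k
B k (suc a) b = δ (suc (a + b)) k +ᶻ (δ (suc a) (b + suc k) +ᶻ δ b (suc a + k))

laurent-telescope : ∀ k x → laurent k x +ᶻ laurent k (suc x) ≡ δ x k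
laurent-telescope zero zero = refl
laurent-telescope zero (suc x) = refl
laurent-telescope (suc k) zero = ℤP.+-inverseˡ (laurent k 0)
laurent-telescope (suc k) (suc x) = laurent-telescope k x

laurent-fold : ∀ k a b → laurent k (dist (suc a) b) +ᶻ laurent k (dist a b) ≡ δ (suc a) (b + suc k) +ᶻ δ b (suc a + k)
laurent-fold k zero zero =
  trans (ℤP.+-comm (laurent k 1) (laurent k 0)) (trans (laurent-telescope k 0) (sym (ℤP.+-identityʳ (δ 0 k))))
laurent-fold k (suc a) zero =
  trans (ℤP.+-comm (laurent k (suc (suc a))) (laurent k (suc a)))
        (trans (laurent-telescope k (suc a)) (sym (ℤP.+-identityʳ (δ (suc a) k))))
laurent-fold k zero (suc b) =
  trans (laurent-telescope k b)
        (sym (trans (cong (_+ᶻ δ b k) (δ-≢ (λ eq → ℕP.0≢1+n (trans eq (ℕP.+-suc b k))))) (ℤP.+-identityˡ (δ b k))))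
laurent-fold k (suc a) (suc b) = laurent-fold k a b

B-explicit : ∀ k a b → withPrevRow (closedForm k) a b ≡ B k a b
B-explicit k zero b = laurent-telescope k b
B-explicit k (suc a) b =
  trans (regroup (laurent k (dist (suc a) b)) (laurent k (suc (suc (a + b)))) (laurent k (dist a b)) (laurent k (suc (a + b))))
        (cong₂ _+ᶻ_ (laurent-telescope k (suc (a + b))) (laurent-fold k a b))
  where
  regroup : ∀ p q r t → (p +ᶻ q) +ᶻ (r +ᶻ t) ≡ (t +ᶻ q) +ᶻ (p +ᶻ r)
  regroup = solve-∀

Det-g-B : ∀ k N → Det N (evalγ (g k)) ≡ Det N (B k)
Det-g-B k N = begin
    Det N (evalγ (g k))                 ≡⟨ Det-cong N (λ a b _ _ → evalγ-g k a b) ⟩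
    Det N (closedForm k)                ≡⟨ sym (Det-withPrevRow N (closedForm k)) ⟩
    Det N (withPrevRow (closedForm k))  ≡⟨ Det-cong N (λ a b _ _ → B-explicit k a b) ⟩
    Det N (B k)                         ∎
  where open ≡-Reasoning

-- In terms of reflected indices i, j with A + i + 1 = b + j + 1 (both equal to
-- the size of the truncation): A = b + d implies j = d + i ...
shift→ : ∀ {A b i j d} → A + suc i ≡ b + suc j → A ≡ b + d → j ≡ d + i
shift→ {b = b} {i} {j} {d} eq refl =
  sym (ℕP.suc-injective (trans (sym (ℕP.+-suc d i))
    (ℕP.+-cancelˡ-≡ b (d + suc i) (suc j) (trans (sym (ℕP.+-assoc b d (suc i))) eq))))

shift← : ∀ {A b i j d} → A + suc i ≡ b + suc j → j ≡ d + i → A ≡ b + d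
shift← {A} {b} {i} {d = d} eq refl = ℕP.+-cancelʳ-≡ (suc i) A (b + d) (trans eq (regroup b d i))
  where
  regroup : ∀ b d i → b + suc (d + i) ≡ b + d + suc i
  regroup = ℕSolver.solve-∀

sgn-double : ∀ n → sgn (n + n) ≡ 1ℤ
sgn-double n = trans (sgn-+ n n) (sgn-square n)

sgn-pronic : ∀ k → sgn (k * suc k) ≡ 1ℤ
sgn-pronic zero = refl
sgn-pronic (suc k) = begin
    sgn (suc k * suc (suc k))               ≡⟨ cong sgn (expand k) ⟩
    sgn (k * suc k + (suc k + suc k))       ≡⟨ sgn-+ (k * suc k) (suc k + suc k) ⟩
    sgn (k * suc k) *ᶻ sgn (suc k + suc k)  ≡⟨ cong₂ _*ᶻ_ (sgn-pronic k) (sgn-double (suc k)) ⟩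
    1ℤ                                      ∎
  where
  open ≡-Reasoning
  expand : ∀ k → suc k * suc (suc k) ≡ k * suc k + (suc k + suc k)
  expand = ℕSolver.solve-∀

-- Periodicity: Det (p + 2k + 1) (B k) = Det p (B k), by peeling the
-- bottom-right corner of the (p + 2k + 1)-truncation.
module Periodicity (k p : ℕ) where

  N : ℕ
  N = k + (suc k + p)

  -- Rows A ≥ N - k of the N-truncation keep only the one at column A - k - 1.
  B-bottom : ∀ {A b i j} → A + suc i ≡ N → b + suc j ≡ N → i < k → B k A b ≡ δ j (suc k + i)
  B-bottom {A} {b} {i} {j} eA eb i<k = entries A k<A eA
    where
    k<A : k < A
    k<A = ℕP.+-cancelˡ-≤ k (suc k) A
      (ℕP.≤-trans (ℕP.+-monoʳ-≤ k (ℕP.m≤m+n (suc k) p))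
      (ℕP.≤-trans (ℕP.≤-reflexive (sym eA)) (ℕP.≤-trans (ℕP.+-monoʳ-≤ A i<k) (ℕP.≤-reflexive (ℕP.+-comm A k)))))
    b<A+k : ∀ A → A + suc i ≡ N → b < A + k
    b<A+k A eA = ℕP.<-≤-trans (subst (b <_) eb (ℕP.m<m+n b (s≤s z≤n)))
                              (ℕP.≤-trans (ℕP.≤-reflexive (sym eA)) (ℕP.+-monoʳ-≤ A i<k))
    -- only the left term survives
    entries : ∀ A → k < A → A + suc i ≡ N → B k A b ≡ δ j (suc k + i)
    entries (suc a) k<A eA =
      trans (cong₂ _+ᶻ_ antidiagonal (cong₂ _+ᶻ_ left right)) (trans (ℤP.+-identityˡ _) (ℤP.+-identityʳ _))
      where
      eAb = trans eA (sym eb)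
      antidiagonal : δ (suc (a + b)) k ≡ 0ℤ
      antidiagonal = δ-≢ (λ eq → ℕP.<⇒≢ (ℕP.<-≤-trans k<A (s≤s (ℕP.m≤m+n a b))) (sym eq))
      left : δ (suc a) (b + suc k) ≡ δ j (suc k + i)
      left = δ-iff (shift→ {suc a} {d = suc k} eAb) (shift← {suc a} {d = suc k} eAb)
      right : δ b (suc a + k) ≡ 0ℤ
      right = δ-≢ (ℕP.<⇒≢ (b<A+k (suc a) eA))

  -- Rows k, …, N - k - 1, restricted to the columns N - k - 1, …, N - 1,
  -- form the identity matrix (read from the bottom-right corner).
  B-left : ∀ {A b a j} → A + suc (k + a) ≡ N → b + suc j ≡ N → j ≤ k → B k A b ≡ δ a j
  B-left {A} {b} {a} {j} eA eb j≤k =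
    entries A eA (ℕP.+-cancelˡ-≡ k (A + suc a) (suc k + p) (trans (regroup A k a) eA))
    where
    regroup : ∀ A k a → k + (A + suc a) ≡ A + suc (k + a)
    regroup = ℕSolver.solve-∀
    k+p≤b : k + p ≤ b
    k+p≤b = ℕP.+-cancelʳ-≤ (suc j) (k + p) b
      (ℕP.≤-trans (ℕP.+-monoʳ-≤ (k + p) (s≤s j≤k))
      (ℕP.≤-trans (ℕP.≤-reflexive (reorder k p)) (ℕP.≤-reflexive (sym eb))))
      where
      reorder : ∀ k p → k + p + suc k ≡ k + (suc k + p)
      reorder = ℕSolver.solve-∀
    k≤b : k ≤ b
    k≤b = ℕP.≤-trans (ℕP.m≤m+n k p) k+p≤b
    -- row 0 is e_k; in the other rows only the right term survives
    entries : ∀ A → A + suc (k + a) ≡ N → A + suc a ≡ suc k + p → B k A b ≡ δ a j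
    entries zero eA ea =
      δ-iff (λ b≡k → shift→ {d = 0} eb′ (trans b≡k (sym (ℕP.+-identityʳ k))))
            (λ a≡j → trans (shift← {d = 0} eb′ a≡j) (ℕP.+-identityʳ k))
      where
      eb′ : b + suc j ≡ k + suc a
      eb′ = trans eb (trans (sym eA) (sym (ℕP.+-suc k a)))
    entries (suc a′) eA ea =
      trans (cong₂ _+ᶻ_ antidiagonal (cong₂ _+ᶻ_ left right)) (trans (ℤP.+-identityˡ _) (ℤP.+-identityˡ _))
      where
      ebA = trans eb (sym eA)
      antidiagonal : δ (suc (a′ + b)) k ≡ 0ℤ
      antidiagonal = δ-≢ (λ eq → ℕP.<⇒≢ (s≤s (ℕP.≤-trans k≤b (ℕP.m≤n+m b a′))) (sym eq))
      left : δ (suc a′) (b + suc k) ≡ 0ℤ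
      left = δ-≢ (ℕP.<⇒≢ (ℕP.<-≤-trans (subst (suc a′ <_) ea (ℕP.m<m+n (suc a′) (s≤s z≤n)))
                  (ℕP.≤-trans (s≤s k+p≤b) (ℕP.≤-trans (ℕP.m≤m+n (suc b) k) (ℕP.≤-reflexive (sym (ℕP.+-suc b k)))))))
      right : δ b (suc a′ + k) ≡ δ a j
      right = δ-iff (λ eq → ℕP.+-cancelˡ-≡ k a j (shift→ {d = k} ebA eq)) (λ { refl → shift← {d = k} ebA refl })

  R : InfMat
  R i j = B k (N ∸ suc i) (N ∸ suc j)

  -- R without its first k rows and the columns c+1, …, 2k they hit
  R′ : InfMat
  R′ a b = R (k + a) (skip (suc k) k b)

  reflected : ∀ {i} → i < N → N ∸ suc i + suc i ≡ N
  reflected i<N = ℕP.m∸n+n≡m i<N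

  R-rows : ∀ i b → i < k → b < N → R i b ≡ δ b (suc k + i)
  R-rows i b i<k b<N = B-bottom (reflected (ℕP.<-≤-trans i<k (ℕP.m≤m+n k (suc k + p)))) (reflected b<N) i<k

  R′-columns : ∀ a j → j < suc k → a < suc k + p → R′ a j ≡ δ a j
  R′-columns a j j<sk a<sk+p =
    trans (cong (R (k + a)) (skip-below (suc k) k j j<sk))
          (B-left (reflected (ℕP.+-monoʳ-< k a<sk+p)) (reflected j<N) (ℕP.≤-pred j<sk))
    where
    j<N : j < N
    j<N = ℕP.≤-trans j<sk (ℕP.≤-trans (ℕP.m≤m+n (suc k) p) (ℕP.m≤n+m (suc k + p) k))

  reflect-shift : ∀ x y → y ≡ (k + suc k) + suc x → N ∸ y ≡ p ∸ suc x
  reflect-shift x y refl =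
    trans (cong (_∸ ((k + suc k) + suc x)) (sym (ℕP.+-assoc k (suc k) p))) (ℕP.[m+n]∸[m+o]≡n∸o (k + suc k) p (suc x))

  corner : ∀ a b → R′ (suc k + a) (suc k + b) ≡ B k (p ∸ suc a) (p ∸ suc b)
  corner a b = cong₂ (B k) (reflect-shift a _ (rowIndex k a))
    (trans (cong (λ t → N ∸ suc t) (skip-above (suc k) k b)) (reflect-shift b _ (columnIndex k b)))
    where
    rowIndex : ∀ k a → suc (k + (suc k + a)) ≡ (k + suc k) + suc a
    rowIndex = ℕSolver.solve-∀
    columnIndex : ∀ k b → suc (suc k + (k + b)) ≡ (k + suc k) + suc b
    columnIndex = ℕSolver.solve-∀

  Det-B-periodic : Det N (B k) ≡ Det p (B k)
  Det-B-periodic = begin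
      Det N (B k)                                          ≡⟨ sym (Det-reverse N (B k)) ⟩
      Det N R                                              ≡⟨ Det-peel-rows k (suc k + p) (suc k) R (ℕP.m≤m+n (suc k) p) R-rows ⟩
      sgn (k * suc k) *ᶻ Det (suc k + p) R′                ≡⟨ cong₂ _*ᶻ_ (sgn-pronic k) (Det-peel-columns (suc k) p R′ R′-columns) ⟩
      1ℤ *ᶻ Det p (λ a b → R′ (suc k + a) (suc k + b))     ≡⟨ ℤP.*-identityˡ _ ⟩
      Det p (λ a b → R′ (suc k + a) (suc k + b))           ≡⟨ Det-cong p (λ a b _ _ → corner a b) ⟩
      Det p (λ a b → B k (p ∸ suc a) (p ∸ suc b))          ≡⟨ Det-reverse p (B k) ⟩
      Det p (B k)                                          ∎
    where open ≡-Reasoning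

-- Below size k + 1, row 0 (= e_k) is cut to zero.
Det-B-short : ∀ k r → r < k → Det (suc r) (B k) ≡ 0ℤ
Det-B-short k r r<k = Det-row-zero r (B k) (λ b b≤r → δ-≢ (ℕP.<⇒≢ (ℕP.≤-<-trans (ℕP.≤-pred b≤r) r<k)))

sgn-power : ∀ n → sgn n ≡ (- 1ℤ) ^ n
sgn-power zero = refl
sgn-power (suc n) = trans (cong -_ (sgn-power n)) (sym (ℤP.-1*i≡-i _))

Det-antidiagonal : ∀ n → Det (suc n) (λ a b → δ (a + b) n) ≡ (- 1ℤ) ^ (suc n C 2)
Det-antidiagonal zero = refl
Det-antidiagonal (suc n) = begin
    Det (suc (suc n)) J
      ≡⟨ Det-row-single (suc n) (suc n) J ℕP.≤-refl (λ b _ b≢ → δ-≢ b≢) ⟩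
    (sgn (suc n) *ᶻ δ (suc n) (suc n)) *ᶻ Det (suc n) (minor (suc n) J)
      ≡⟨ cong₂ (λ u v → (sgn (suc n) *ᶻ u) *ᶻ v) (δ-≡ {suc n} refl)
               (Det-cong (suc n) (λ a b _ b<n → cong (λ t → δ (a + t) n) (skip-below (suc n) 1 b b<n))) ⟩
    (sgn (suc n) *ᶻ 1ℤ) *ᶻ Det (suc n) (λ a b → δ (a + b) n)
      ≡⟨ cong₂ _*ᶻ_ (trans (ℤP.*-identityʳ _) (sgn-power (suc n))) (Det-antidiagonal n) ⟩
    (- 1ℤ) ^ suc n *ᶻ (- 1ℤ) ^ (suc n C 2)
      ≡⟨ sym (ℤP.^-distribˡ-+-* (- 1ℤ) (suc n) (suc n C 2)) ⟩
    (- 1ℤ) ^ (suc n + suc n C 2)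
      ≡⟨ cong (λ t → (- 1ℤ) ^ (t + suc n C 2)) (sym (nC1≡n (suc n))) ⟩
    (- 1ℤ) ^ (suc n C 1 + suc n C 2)
      ≡⟨ cong ((- 1ℤ) ^_) (nCk+nC[k+1]≡[n+1]C[k+1] (suc n) 1) ⟩
    (- 1ℤ) ^ (suc (suc n) C 2) ∎
  where
  open ≡-Reasoning
  J : InfMat
  J a b = δ (a + b) (suc n)

B-antidiagonal : ∀ k a b → a ≤ k → b ≤ k → B k a b ≡ δ (a + b) k
B-antidiagonal k zero b _ _ = refl
B-antidiagonal k (suc a) b a<k b≤k =
  trans (cong (δ (suc (a + b)) k +ᶻ_)
          (cong₂ _+ᶻ_ (δ-≢ (ℕP.<⇒≢ (ℕP.≤-<-trans a<k (ℕP.<-≤-trans (ℕP.n<1+n k) (ℕP.m≤n+m (suc k) b)))))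
                      (δ-≢ (ℕP.<⇒≢ (s≤s (ℕP.≤-trans b≤k (ℕP.m≤n+m k a)))))))
        (ℤP.+-identityʳ _)

Det-B-middle : ∀ k → Det (suc k) (B k) ≡ (- 1ℤ) ^ (suc k C 2)
Det-B-middle k = trans (Det-cong (suc k) (λ a b a≤k b≤k → B-antidiagonal k a b (ℕP.≤-pred a≤k) (ℕP.≤-pred b≤k)))
                       (Det-antidiagonal k)

-- For k + 2 ≤ r ≤ 2k, rows k and k + 1 of the r-truncation are both e_0.
Det-B-collision : ∀ k r → suc (suc k) ≤ r → r ≤ k + k → Det r (B k) ≡ 0ℤ
Det-B-collision zero r (s≤s (s≤s _)) ()
Det-B-collision (suc k) r lo hi = Det-equal-rows r (suc k) (B (suc k)) lo rows
  where
  K = suc k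
  row-K : ∀ b → b < K + K → B K K b ≡ δ b 0
  row-K b b<2K =
    trans (cong₂ _+ᶻ_ (δ-iff (λ eq → ℕP.+-cancelˡ-≡ k b 0 (trans eq (sym (ℕP.+-identityʳ k))))
                             (λ { refl → ℕP.+-identityʳ k }))
                      (cong₂ _+ᶻ_ (δ-≢ (ℕP.<⇒≢ (ℕP.m≤n+m (suc K) b))) (δ-≢ (ℕP.<⇒≢ b<2K))))
          (ℤP.+-identityʳ _)
  row-K+1 : ∀ b → b < K + K → B K (suc K) b ≡ δ b 0
  row-K+1 b b<2K =
    trans (cong₂ _+ᶻ_ (δ-≢ (λ eq → ℕP.<⇒≢ (s≤s (ℕP.m≤m+n K b)) (sym eq)))
                      (cong₂ _+ᶻ_ (δ-iff (λ eq → sym (ℕP.+-cancelʳ-≡ (suc K) 0 b eq)) (λ { refl → refl }))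
                                  (δ-≢ (ℕP.<⇒≢ (ℕP.<-trans b<2K (ℕP.n<1+n (K + K)))))))
          (trans (ℤP.+-identityˡ _) (ℤP.+-identityʳ _))
  rows : ∀ b → b < r → B K K b ≡ B K (suc K) b
  rows b b<r = trans (row-K b (ℕP.<-≤-trans b<r hi)) (sym (row-K+1 b (ℕP.<-≤-trans b<r hi)))

Det-B-remainder : ∀ k r → r < suc (k + k) → r ≢ 0 → r ≢ suc k → Det r (B k) ≡ 0ℤ
Det-B-remainder k zero _ r≢0 _ = ⊥-elim (r≢0 refl)
Det-B-remainder k (suc r) r<M _ r≢sk with ℕP.<-cmp r k
... | tri< r<k _ _ = Det-B-short k r r<k
... | tri≈ _ refl _ = ⊥-elim (r≢sk refl)
... | tri> _ _ k<r = Det-B-collision k (suc r) (s≤s k<r) (ℕP.≤-pred r<M)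

Det-B-mod : ∀ k q r → Det (r + q * suc (k + k)) (B k) ≡ Det r (B k)
Det-B-mod k zero r = cong (λ n → Det n (B k)) (ℕP.+-identityʳ r)
Det-B-mod k (suc q) r =
  trans (cong (λ n → Det n (B k)) (regroup k q r))
        (trans (Periodicity.Det-B-periodic k (r + q * suc (k + k))) (Det-B-mod k q r))
  where
  regroup : ∀ k q r → r + suc q * suc (k + k) ≡ k + (suc k + (r + q * suc (k + k)))
  regroup = ℕSolver.solve-∀

lemma7p5 : (k N : ℕ) →
    ((∃[ n ] N ≡ (2 * k + 1) * n) → det ℤOps (trunc N (evalγ (g k))) ≡ 1ℤ)
    × ((∃[ n ] N ≡ (2 * k + 1) * n + k + 1) → det ℤOps (trunc N (evalγ (g k))) ≡ (- 1ℤ) ^ (suc k C 2))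
    × (¬ (∃[ n ] N ≡ (2 * k + 1) * n) → ¬ (∃[ n ] N ≡ (2 * k + 1) * n + k + 1) → det ℤOps (trunc N (evalγ (g k))) ≡ 0ℤ)
lemma7p5 k N = multiple , shifted-multiple , otherwise
  where
  M = suc (k + k)
  remainder₀ : ∀ n → (2 * k + 1) * n ≡ 0 + n * M
  remainder₀ n = regroup k n
    where
    regroup : ∀ k n → (2 * k + 1) * n ≡ 0 + n * suc (k + k)
    regroup = ℕSolver.solve-∀
  remainder₁ : ∀ n → (2 * k + 1) * n + k + 1 ≡ suc k + n * M
  remainder₁ n = regroup k n
    where
    regroup : ∀ k n → (2 * k + 1) * n + k + 1 ≡ suc k + n * suc (k + k)
    regroup = ℕSolver.solve-∀
  Det-at : ∀ {m n} → m ≡ n → Det m (B k) ≡ Det n (B k)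
  Det-at = cong (λ n → Det n (B k))
  multiple : (∃[ n ] N ≡ (2 * k + 1) * n) → Det N (evalγ (g k)) ≡ 1ℤ
  multiple (n , refl) = trans (Det-g-B k N) (trans (Det-at (remainder₀ n)) (Det-B-mod k n 0))
  shifted-multiple : (∃[ n ] N ≡ (2 * k + 1) * n + k + 1) → Det N (evalγ (g k)) ≡ (- 1ℤ) ^ (suc k C 2)
  shifted-multiple (n , refl) =
    trans (Det-g-B k N) (trans (Det-at (remainder₁ n)) (trans (Det-B-mod k n (suc k)) (Det-B-middle k)))
  otherwise : ¬ (∃[ n ] N ≡ (2 * k + 1) * n) → ¬ (∃[ n ] N ≡ (2 * k + 1) * n + k + 1) → Det N (evalγ (g k)) ≡ 0ℤ
  otherwise not₀ not₁ =
    trans (Det-g-B k N) (trans (Det-at division) (trans (Det-B-mod k (N / M) (N % M))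
          (Det-B-remainder k (N % M) (m%n<n N M) r≢0 r≢k+1)))
    where
    division : N ≡ N % M + (N / M) * M
    division = m≡m%n+[m/n]*n N M
    r≢0 : N % M ≢ 0
    r≢0 r≡0 = not₀ (N / M , trans division (trans (cong (_+ (N / M) * M) r≡0) (sym (remainder₀ (N / M)))))
    r≢k+1 : N % M ≢ suc k
    r≢k+1 r≡k+1 = not₁ (N / M , trans division (trans (cong (_+ (N / M) * M) r≡k+1) (sym (remainder₁ (N / M)))))
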